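{- For every $n\neq 4$, $\mathrm{ex}(n,M_2,P_4)=\mathcal{N}(M_2,D(3,n))$, and $\mathrm{ex}(4,M_2,P_4)=1$.
   Context: $M_2$ is the matching with two edges (4 vertices), $P_4$ the path on $4$ vertices (3 edges). $D(k,n)$ is the $n$-vertex graph consisting of $\lfloor n/k\rfloor$ vertex-disjoint copies of $K_k$ together with a clique on the remaining $n-k\lfloor n/k\rfloor$ vertices. $\mathcal{N}(H,G)$ is the number of subgraphs of $G$ isomorphic to $H$; $\mathrm{ex}(n,H,F)$ is the maximum of $\mathcal{N}(H,G)$ over $F$-free $n$-vertex graphs $G$. -}

module Defs where

open import Data.Bool using (Bool; true; false; if_then_else_; _∧_)
open import Data.Nat using (ℕ; zero; suc; _+_; _<_; _≤_; _/_)
open import Data.Fin using (Fin; toℕ)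
open import Data.List using (List; map; allFin)
open import Data.Nat.ListAction using (sum)
open import Relation.Nullary.Decidable using (dec-false; dec-true)
open import Data.Product using (Σ; _×_; ∃-syntax)
open import Relation.Binary.PropositionalEquality using (_≡_; _≢_; refl; sym; trans; cong₂)
open import Relation.Nullary using (¬_; does; yes; no; Dec)
open import Data.Empty using (⊥-elim)
open import Data.Fin.Properties using () renaming (_≟_ to _≟ᶠ_)
open import Data.Nat.Properties using () renaming (_≟_ to _≟ℕ_; _<?_ to _<?ℕ_)

record Graph (n : ℕ) : Set where
  field
    adj    : Fin n → Fin n → Bool
    adj-sym    : ∀ i j → adj i j ≡ adj j i
    adj-irrefl : ∀ i → adj i i ≡ false
open Graph public

Σv : ∀ {n} → (Fin n → ℕ) → ℕ
Σv {n} f = sum (map f (allFin n))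

b2n : Bool → ℕ
b2n true  = 1
b2n false = 0

_<ᵇ_ : ∀ {n} → Fin n → Fin n → Bool
i <ᵇ j = does (toℕ i <?ℕ toℕ j)

_≠ᵇ_ : ∀ {n} → Fin n → Fin n → Bool
i ≠ᵇ j = if does (i ≟ᶠ j) then false else true

-- N(M₂, G): number of subgraphs of G isomorphic to M₂, i.e. the number of
-- unordered pairs {ab, cd} of vertex-disjoint edges of G.  Each such pair is
-- counted once via the normalisation a < b, c < d, a < c.
NM2 : ∀ {n} → Graph n → ℕ
NM2 G = Σv λ a → Σv λ b → Σv λ c → Σv λ d →
  b2n (a <ᵇ b ∧ c <ᵇ d ∧ a <ᵇ c ∧ b ≠ᵇ c ∧ b ≠ᵇ d
       ∧ adj G a b ∧ adj G c d)

ContainsP4 : ∀ {n} → Graph n → Set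
ContainsP4 {n} G = ∃[ a ] ∃[ b ] ∃[ c ] ∃[ d ]
  (a ≢ b × a ≢ c × a ≢ d × b ≢ c × b ≢ d × c ≢ d
   × adj G a b ≡ true × adj G b c ≡ true × adj G c d ≡ true)

P4Free : ∀ {n} → Graph n → Set
P4Free G = ¬ ContainsP4 G

-- D(3,n): vertices i ≠ j adjacent iff ⌊i/3⌋ = ⌊j/3⌋.  This gives ⌊n/3⌋
-- disjoint triangles plus a clique on the remaining n - 3⌊n/3⌋ vertices.
D3adj : ∀ {n} → Fin n → Fin n → Bool
D3adj i j = i ≠ᵇ j ∧ does ((toℕ i / 3) ≟ℕ (toℕ j / 3))

≠ᵇ-sym : ∀ {n} (i j : Fin n) → (i ≠ᵇ j) ≡ (j ≠ᵇ i)
≠ᵇ-sym i j with i ≟ᶠ j | j ≟ᶠ i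
... | yes _ | yes _ = refl
... | no _  | no _  = refl
... | yes p | no q  = ⊥-elim (q (sym p))
... | no p  | yes q = ⊥-elim (p (sym q))

≟ℕ-sym-aux : ∀ (x y : ℕ) → Dec (x ≡ y) → does (x ≟ℕ y) ≡ does (y ≟ℕ x)
≟ℕ-sym-aux x y (yes p) = trans (dec-true (x ≟ℕ y) p) (sym (dec-true (y ≟ℕ x) (sym p)))
≟ℕ-sym-aux x y (no p) = trans (dec-false (x ≟ℕ y) p) (sym (dec-false (y ≟ℕ x) (λ q → p (sym q))))

≟ℕ-sym : ∀ (x y : ℕ) → does (x ≟ℕ y) ≡ does (y ≟ℕ x)
≟ℕ-sym x y = ≟ℕ-sym-aux x y (x ≟ℕ y)

D3 : (n : ℕ) → Graph n
adj (D3 n) = D3adj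
adj-sym (D3 n) i j = cong₂ _∧_ (≠ᵇ-sym i j) (≟ℕ-sym (toℕ i / 3) (toℕ j / 3))
adj-irrefl (D3 n) i with i ≟ᶠ i
... | yes _ = refl
... | no p = ⊥-elim (p refl)

ExM2P4 : ℕ → ℕ → Set
ExM2P4 n m = (Σ (Graph n) λ G → P4Free G × NM2 G ≡ m)
           × (∀ (G : Graph n) → P4Free G → NM2 G ≤ m)

module Submission where

-- In a P₄-free graph every component is a triangle or a star, so two edges are
-- disjoint only if they lie in different components.  Every graph with e edges and
-- degree-square sum Q satisfies 2·N(M₂) + Q = e² + e, hence it suffices to bound Q
-- from below.  Sorting vertices by degree (0, 1, 2, ≥ 3) and using P₄-freeness only
-- locally (a neighbour of a vertex of degree ≥ 3, or of a degree-2 vertex outside a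
-- triangle, is a leaf), one counts t triangles and the components of the rest, which
-- gives n = 3t + Y, e = 3t + X and Q ≥ 12t + Q₀ for explicit X, Y, Q₀.  For D(3,n)
-- the identity holds with the exact values, and comparing both sides is elementary
-- arithmetic: the rest on Y vertices never beats D(3,Y), except for two disjoint
-- edges on four vertices, which is the exceptional case n = 4.

open import Defs
open import Data.Nat using (ℕ)
open import Data.Product using (_×_)
open import Relation.Binary.PropositionalEquality using (_≢_)

open import Data.Nat using (zero; suc; _+_; _*_; _≤_; _<_; z≤n; s≤s; _/_; _≤?_)
open import Data.Nat.DivMod using (m/n≡1+[m∸n]/n)
open import Data.Nat.Properties
open import Data.Nat.Properties using () renaming (_≟_ to _≟ℕ_)
open import Data.Nat.Tactic.RingSolver using (solve-∀)
open import Data.Fin using (Fin; zero; suc; toℕ; _↑ˡ_)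
open import Data.Fin.Properties using (toℕ-injective) renaming (_≟_ to _≟ᶠ_)
open import Data.Bool using (Bool; true; false; _∧_; _∨_; not)
open import Data.Bool.Properties using (∧-zeroʳ; T-≡; ¬-not)
open import Function.Bundles using (Equivalence)
open import Data.List using (tabulate)
open import Data.List.Properties using (map-tabulate)
import Data.Nat.ListAction as List
open import Data.Product using (_,_; ∃-syntax)
open import Data.Sum using (_⊎_; inj₁; inj₂)
open import Relation.Binary.Definitions using (tri<; tri≈; tri>)
open import Data.Empty using (⊥; ⊥-elim)
open import Function using (_∘_; id)
open import Relation.Binary.PropositionalEquality
  using (_≡_; refl; sym; trans; cong; cong₂; subst; ≢-sym; module ≡-Reasoning)
open import Relation.Nullary using (¬_; Dec; does; yes; no)
open import Relation.Nullary.Decidable using (dec-true; dec-false)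
open import Algebra.Properties.Semiring.Sum +-*-semiring
  using (sum; sum-syntax; sum-cong-≗; ∑-distrib-+; ∑-comm; *-distribˡ-sum; *-distribʳ-sum)

Σv≡sum : ∀ {n} (f : Fin n → ℕ) → Σv f ≡ sum f
Σv≡sum f = trans (cong List.sum (map-tabulate id f)) (sum-tabulate f)
  where
  sum-tabulate : ∀ {n} (f : Fin n → ℕ) → List.sum (tabulate f) ≡ sum f
  sum-tabulate {zero} f = refl
  sum-tabulate {suc n} f = cong (f zero +_) (sum-tabulate (f ∘ suc))

sum-mono-≤ : ∀ {n} {f g : Fin n → ℕ} → (∀ i → f i ≤ g i) → sum f ≤ sum g
sum-mono-≤ {zero} f≤g = z≤n
sum-mono-≤ {suc n} f≤g = +-mono-≤ (f≤g zero) (sum-mono-≤ (f≤g ∘ suc))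

sum-const : ∀ n k → ∑[ i < n ] k ≡ n * k
sum-const zero k = refl
sum-const (suc n) k = cong (k +_) (sum-const n k)

sum-zero : ∀ {n} {f : Fin n → ℕ} → (∀ i → f i ≡ 0) → sum f ≡ 0
sum-zero {n} f≡0 = trans (sum-cong-≗ f≡0) (trans (sum-const n 0) (*-zeroʳ n))

sum≡0⇒≡0 : ∀ {n} (f : Fin n → ℕ) → sum f ≡ 0 → ∀ i → f i ≡ 0
sum≡0⇒≡0 f eq zero = m+n≡0⇒m≡0 (f zero) eq
sum≡0⇒≡0 f eq (suc i) = sum≡0⇒≡0 (f ∘ suc) (m+n≡0⇒n≡0 (f zero) eq) i

∑-distrib-+₃ : ∀ {n} (f g h : Fin n → ℕ) → ∑[ i < n ] (f i + g i + h i) ≡ sum f + sum g + sum h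
∑-distrib-+₃ f g h = trans (∑-distrib-+ (λ i → f i + g i) h) (cong (_+ sum h) (∑-distrib-+ f g))

term≤sum : ∀ {n} (f : Fin n → ℕ) i → f i ≤ sum f
term≤sum f zero = m≤m+n (f zero) _
term≤sum f (suc i) = ≤-trans (term≤sum (f ∘ suc) i) (m≤n+m _ (f zero))

sum-pos⇒∃ : ∀ {n} (f : Fin n → ℕ) → 0 < sum f → ∃[ i ] 0 < f i
sum-pos⇒∃ {suc n} f pos with f zero in eq
... | suc _ = zero , subst (0 <_) (sym eq) (s≤s z≤n)
... | zero with sum-pos⇒∃ (f ∘ suc) pos
...   | i , fi>0 = suc i , fi>0

sum-head-zero : ∀ {n} {f : Fin (suc n) → ℕ} → f zero ≡ 0 → sum f ≡ sum (f ∘ suc)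
sum-head-zero {f = f} f₀≡0 = cong (_+ sum (f ∘ suc)) f₀≡0

∑∑-scale : ∀ {m n} k (f : Fin m → Fin n → ℕ) → ∑[ i < m ] ∑[ j < n ] (k * f i j) ≡ k * ∑[ i < m ] ∑[ j < n ] f i j
∑∑-scale k f = trans (sum-cong-≗ λ i → sym (*-distribˡ-sum k (f i))) (sym (*-distribˡ-sum k (λ i → sum (f i))))

ind : ∀ {n} → Fin n → Fin n → ℕ
ind i j = b2n (does (i ≟ᶠ j))

sum-ind : ∀ {n} (i : Fin n) (f : Fin n → ℕ) → ∑[ j < n ] (ind i j * f j) ≡ f i
sum-ind {suc n} zero f = trans (cong (f zero + 0 +_) (sum-zero {n} λ _ → refl)) (trans (+-identityʳ _) (+-identityʳ _))
sum-ind {suc n} (suc i) f = sum-ind i (f ∘ suc)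

sum-ind-count : ∀ {n} (u : Fin n) → ∑[ w < n ] ind u w ≡ 1
sum-ind-count u = trans (sum-cong-≗ λ w → sym (*-identityʳ (ind u w))) (sum-ind u λ _ → 1)

sum-ind₂ : ∀ {n} (a b : Fin n) (f : Fin n → ℕ) → ∑[ w < n ] ((ind a w + ind b w) * f w) ≡ f a + f b
sum-ind₂ a b f =
  trans (sum-cong-≗ λ w → *-distribʳ-+ (f w) (ind a w) (ind b w))
  (trans (∑-distrib-+ (λ w → ind a w * f w) (λ w → ind b w * f w)) (cong₂ _+_ (sum-ind a f) (sum-ind b f)))

sum-ind₃ : ∀ {n} (a b c : Fin n) (f : Fin n → ℕ) → ∑[ w < n ] ((ind a w + ind b w + ind c w) * f w) ≡ f a + f b + f c
sum-ind₃ a b c f =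
  trans (sum-cong-≗ λ w → *-distribʳ-+ (f w) (ind a w + ind b w) (ind c w))
  (trans (∑-distrib-+ (λ w → (ind a w + ind b w) * f w) (λ w → ind c w * f w)) (cong₂ _+_ (sum-ind₂ a b f) (sum-ind c f)))

ind-self : ∀ {n} (x : Fin n) → ind x x ≡ 1
ind-self x = cong b2n (dec-true (x ≟ᶠ x) refl)

ind-≢ : ∀ {n} {x y : Fin n} → x ≢ y → ind x y ≡ 0
ind-≢ {x = x} {y} x≢y = cong b2n (dec-false (x ≟ᶠ y) x≢y)

ind-disjoint₂ : ∀ {n} {a b : Fin n} → a ≢ b → ∀ w → ind a w + ind b w ≤ 1
ind-disjoint₂ {a = a} {b} a≢b w with a ≟ᶠ w | b ≟ᶠ w
... | yes refl | yes refl = ⊥-elim (a≢b refl)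
... | yes _ | no _ = ≤-refl
... | no _ | yes _ = ≤-refl
... | no _ | no _ = z≤n

ind-disjoint₃ : ∀ {n} {a b c : Fin n} → a ≢ b → a ≢ c → b ≢ c → ∀ w → ind a w + ind b w + ind c w ≤ 1
ind-disjoint₃ {a = a} {b} {c} a≢b a≢c b≢c w with a ≟ᶠ w | b ≟ᶠ w | c ≟ᶠ w
... | yes refl | yes refl | _ = ⊥-elim (a≢b refl)
... | yes refl | _ | yes refl = ⊥-elim (a≢c refl)
... | _ | yes refl | yes refl = ⊥-elim (b≢c refl)
... | yes _ | no _ | no _ = ≤-refl
... | no _ | yes _ | no _ = ≤-refl
... | no _ | no _ | yes _ = ≤-refl
... | no _ | no _ | no _ = z≤n

sum-weighted≤sum : ∀ {n} (I f : Fin n → ℕ) → (∀ w → I w ≤ 1) → ∑[ w < n ] (I w * f w) ≤ sum f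
sum-weighted≤sum I f I≤1 = sum-mono-≤ λ w → ≤-trans (*-monoˡ-≤ (f w) (I≤1 w)) (≤-reflexive (*-identityˡ (f w)))

m*n>0⇒n>0 : ∀ m {n} → 0 < m * n → 0 < n
m*n>0⇒n>0 m {zero} pos rewrite *-zeroʳ m = pos
m*n>0⇒n>0 m {suc n} _ = s≤s z≤n

≤-by-slack : ∀ {a b} k → a + k ≡ b → a ≤ b
≤-by-slack {a} k a+k≡b = ≤-trans (m≤m+n a k) (≤-reflexive a+k≡b)

*-zero-factor : ∀ {t} l m → t ≡ 0 → l * t ≡ m * t
*-zero-factor l m refl = trans (*-zeroʳ l) (sym (*-zeroʳ m))

5≰4 : ∀ {m} → 5 ≤ m → m ≤ 4 → ⊥
5≰4 5≤m m≤4 = <-irrefl refl (≤-trans 5≤m m≤4)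

b2n-pos : ∀ {x} → 0 < b2n x → x ≡ true
b2n-pos {true} _ = refl

∧-true-left : ∀ {x y} → x ∧ y ≡ true → x ≡ true
∧-true-left {true} _ = refl

∧-true-right : ∀ {x y} → x ∧ y ≡ true → y ≡ true
∧-true-right {true} eq = eq

does-true : ∀ {P : Set} (d : Dec P) → does d ≡ true → P
does-true (yes p) _ = p

does-false : ∀ {P : Set} (d : Dec P) → does d ≡ false → ¬ P
does-false (no ¬p) _ = ¬p

≠ᵇ-true : ∀ {n} {i j : Fin n} → i ≢ j → i ≠ᵇ j ≡ true
≠ᵇ-true {i = i} {j} i≢j with i ≟ᶠ j
... | yes i≡j = ⊥-elim (i≢j i≡j)
... | no _ = refl

<ᵇ-true : ∀ {n} {i j : Fin n} → toℕ i < toℕ j → i <ᵇ j ≡ true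
<ᵇ-true i<j = Equivalence.to T-≡ (<⇒<ᵇ i<j)

<ᵇ-true⁻ : ∀ {n} {i j : Fin n} → i <ᵇ j ≡ true → toℕ i < toℕ j
<ᵇ-true⁻ {i = i} {j} eq = <ᵇ⇒< (toℕ i) (toℕ j) (Equivalence.from T-≡ eq)

<ᵇ-false : ∀ {n} {i j : Fin n} → ¬ toℕ i < toℕ j → i <ᵇ j ≡ false
<ᵇ-false {i = i} i≮j = ¬-not (i≮j ∘ <ᵇ-true⁻ {i = i})

<ᵇ-irrefl : ∀ {n} (i : Fin n) → i <ᵇ i ≡ false
<ᵇ-irrefl i = <ᵇ-false {i = i} {i} (<-irrefl refl)

lt : ∀ {n} → Fin n → Fin n → ℕ
lt a b = b2n (a <ᵇ b)

lt≡1 : ∀ {n} {a b : Fin n} → toℕ a < toℕ b → lt a b ≡ 1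
lt≡1 {a = a} a<b = cong b2n (<ᵇ-true {i = a} a<b)

lt≡0 : ∀ {n} {a b : Fin n} → ¬ toℕ a < toℕ b → lt a b ≡ 0
lt≡0 {a = a} a≮b = cong b2n (<ᵇ-false {i = a} a≮b)

lt-irrefl : ∀ {n} (a : Fin n) → lt a a ≡ 0
lt-irrefl a = cong b2n (<ᵇ-irrefl a)

lt-connex : ∀ {n} {a b : Fin n} → a ≢ b → lt a b + lt b a ≡ 1
lt-connex {a = a} {b} a≢b with <-cmp (toℕ a) (toℕ b)
... | tri< a<b _ _ = cong₂ _+_ (lt≡1 a<b) (lt≡0 {a = b} (<⇒≯ a<b))
... | tri≈ _ a≡b _ = ⊥-elim (a≢b (toℕ-injective a≡b))
... | tri> _ _ b<a = cong₂ _+_ (lt≡0 {a = a} (<⇒≯ b<a)) (lt≡1 b<a)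

lt-between : ∀ {n} {x y z : Fin n} → x ≢ y → x ≢ z →
  lt y z ≡ lt x y * lt y z + lt y x * lt x z + lt y z * lt z x
lt-between {x = x} {y} {z} x≢y x≢z with <-cmp (toℕ x) (toℕ y) | <-cmp (toℕ x) (toℕ z)
... | tri≈ _ x≡y _ | _ = ⊥-elim (x≢y (toℕ-injective x≡y))
... | tri< _ _ _ | tri≈ _ x≡z _ = ⊥-elim (x≢z (toℕ-injective x≡z))
... | tri> _ _ _ | tri≈ _ x≡z _ = ⊥-elim (x≢z (toℕ-injective x≡z))
... | tri< x<y _ _ | tri< x<z _ _ =
  x-smallest (lt≡1 x<y) (lt≡0 {a = y} (<⇒≯ x<y)) (lt≡1 x<z) (lt≡0 {a = z} (<⇒≯ x<z))
  where
  x-smallest : ∀ {p p′ r r′ q} → p ≡ 1 → p′ ≡ 0 → r ≡ 1 → r′ ≡ 0 → q ≡ p * q + p′ * r + q * r′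
  x-smallest {q = q} refl refl refl refl = identity q
    where
    identity : ∀ q → q ≡ 1 * q + 0 * 1 + q * 0
    identity = solve-∀
... | tri< x<y _ _ | tri> _ _ z<x =
  x-middle (lt≡1 x<y) (lt≡0 {a = y} (<⇒≯ x<y)) (lt≡0 {a = x} (<⇒≯ z<x)) (lt≡1 z<x) (lt≡0 {a = y} (<⇒≯ (<-trans z<x x<y)))
  where
  x-middle : ∀ {p p′ r r′ q} → p ≡ 1 → p′ ≡ 0 → r ≡ 0 → r′ ≡ 1 → q ≡ 0 → q ≡ p * q + p′ * r + q * r′
  x-middle refl refl refl refl refl = refl
... | tri> _ _ y<x | tri< x<z _ _ =
  x-middle′ (lt≡0 {a = x} (<⇒≯ y<x)) (lt≡1 y<x) (lt≡1 x<z) (lt≡0 {a = z} (<⇒≯ x<z)) (lt≡1 (<-trans y<x x<z))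
  where
  x-middle′ : ∀ {p p′ r r′ q} → p ≡ 0 → p′ ≡ 1 → r ≡ 1 → r′ ≡ 0 → q ≡ 1 → q ≡ p * q + p′ * r + q * r′
  x-middle′ refl refl refl refl refl = refl
... | tri> _ _ y<x | tri> _ _ z<x =
  x-largest (lt≡0 {a = x} (<⇒≯ y<x)) (lt≡1 y<x) (lt≡0 {a = x} (<⇒≯ z<x)) (lt≡1 z<x)
  where
  x-largest : ∀ {p p′ r r′ q} → p ≡ 0 → p′ ≡ 1 → r ≡ 0 → r′ ≡ 1 → q ≡ p * q + p′ * r + q * r′
  x-largest {q = q} refl refl refl refl = sym (*-identityʳ q)

sum-symmetric : ∀ {n} (B : Fin n → Fin n → ℕ) → (∀ a b → B a b ≡ B b a) → (∀ a → B a a ≡ 0) →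
  ∑[ a < n ] ∑[ b < n ] B a b ≡ 2 * ∑[ a < n ] ∑[ b < n ] (lt a b * B a b)
sum-symmetric {n} B B-sym B-diag = begin
  ∑[ a < n ] ∑[ b < n ] B a b
    ≡⟨ sum-cong-≗ (λ a → trans (sum-cong-≗ (split a)) (∑-distrib-+ (λ b → lt a b * B a b) (λ b → lt b a * B a b))) ⟩
  ∑[ a < n ] (∑[ b < n ] (lt a b * B a b) + ∑[ b < n ] (lt b a * B a b))
    ≡⟨ ∑-distrib-+ (λ a → ∑[ b < n ] (lt a b * B a b)) (λ a → ∑[ b < n ] (lt b a * B a b)) ⟩
  X + ∑[ a < n ] ∑[ b < n ] (lt b a * B a b)
    ≡⟨ cong (X +_) (trans (∑-comm (λ a b → lt b a * B a b))
                          (sum-cong-≗ λ b → sum-cong-≗ λ a → cong (lt b a *_) (B-sym a b))) ⟩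
  X + X
    ≡⟨ cong (X +_) (+-identityʳ X) ⟨
  2 * X ∎
  where
  open ≡-Reasoning
  X = ∑[ a < n ] ∑[ b < n ] (lt a b * B a b)
  split : ∀ a b → B a b ≡ lt a b * B a b + lt b a * B a b
  split a b with a ≟ᶠ b
  ... | yes refl rewrite B-diag a | *-zeroʳ (lt a a) = refl
  ... | no a≢b = trans (sym (*-identityˡ (B a b)))
                   (trans (cong (_* B a b) (sym (lt-connex a≢b))) (*-distribʳ-+ (B a b) (lt a b) (lt b a)))

-- Degrees and the identity 2·N(M₂) + Σ deg² = e² + e

deg : ∀ {n} → Graph n → Fin n → ℕ
deg {n} G v = ∑[ u < n ] b2n (adj G v u)

degSum : ∀ {n} → Graph n → ℕ
degSum {n} G = ∑[ v < n ] deg G v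

degSqSum : ∀ {n} → Graph n → ℕ
degSqSum {n} G = ∑[ v < n ] (deg G v * deg G v)

edgeCount : ∀ {n} → Graph n → ℕ
edgeCount {n} G = ∑[ a < n ] ∑[ b < n ] b2n (a <ᵇ b ∧ adj G a b)

adj-swap : ∀ {n} (G : Graph n) {x y} → adj G x y ≡ true → adj G y x ≡ true
adj-swap G {x} {y} xy = trans (adj-sym G y x) xy

adj⇒≢ : ∀ {n} (G : Graph n) {x y} → adj G x y ≡ true → x ≢ y
adj⇒≢ G {x} xy refl with () ← trans (sym xy) (adj-irrefl G x)

adj⇒deg≥1 : ∀ {n} (G : Graph n) {u v} → adj G u v ≡ true → 1 ≤ deg G v
adj⇒deg≥1 G {u} {v} uv = ≤-trans (≤-reflexive (cong b2n (sym (trans (adj-sym G v u) uv)))) (term≤sum (λ w → b2n (adj G v w)) u)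

adj-split-by-order : ∀ {n} (G : Graph n) (b u : Fin n) →
  b2n (adj G b u) ≡ b2n (b <ᵇ u ∧ adj G b u) + b2n (u <ᵇ b ∧ adj G u b)
adj-split-by-order G b u with <-cmp (toℕ b) (toℕ u)
... | tri< b<u _ _ rewrite <ᵇ-true {i = b} b<u | <ᵇ-false {i = u} (<⇒≯ b<u) = sym (+-identityʳ _)
... | tri≈ _ b≡u _ rewrite toℕ-injective b≡u | adj-irrefl G u | <ᵇ-irrefl u = refl
... | tri> _ _ u<b rewrite <ᵇ-true {i = u} u<b | <ᵇ-false {i = b} (<⇒≯ u<b) | adj-sym G u b = refl

edge-avoids-or-contains : ∀ {n} (b c d : Fin n) (x : Bool) →
  b2n (c <ᵇ d ∧ x) ≡ b2n (c <ᵇ d ∧ b ≠ᵇ c ∧ b ≠ᵇ d ∧ x) + ind b c * b2n (c <ᵇ d ∧ x) + ind b d * b2n (c <ᵇ d ∧ x)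
edge-avoids-or-contains b c d x with c <ᵇ d in c<d | x | b ≟ᶠ c | b ≟ᶠ d
... | false | _ | yes _ | yes _ = refl
... | false | _ | yes _ | no _ = refl
... | false | _ | no _ | yes _ = refl
... | false | _ | no _ | no _ = refl
... | true | false | yes _ | yes _ = refl
... | true | false | yes _ | no _ = refl
... | true | false | no _ | yes _ = refl
... | true | false | no _ | no _ = refl
... | true | true | yes b≡c | yes b≡d = ⊥-elim (<-irrefl (cong toℕ (trans (sym b≡c) b≡d)) (<ᵇ-true⁻ c<d))
... | true | true | yes _ | no _ = refl
... | true | true | no _ | yes _ = refl
... | true | true | no _ | no _ = refl

edgesAvoiding : ∀ {n} → Graph n → Fin n → ℕ
edgesAvoiding {n} G b = ∑[ c < n ] ∑[ d < n ] b2n (c <ᵇ d ∧ b ≠ᵇ c ∧ b ≠ᵇ d ∧ adj G c d)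

edgeCount≡avoiding+deg : ∀ {n} (G : Graph n) (b : Fin n) → edgeCount G ≡ edgesAvoiding G b + deg G b
edgeCount≡avoiding+deg {n} G b = begin
  edgeCount G
    ≡⟨ sum-cong-≗ (λ c → sum-cong-≗ (λ d → edge-avoids-or-contains b c d (adj G c d))) ⟩
  ∑[ c < n ] ∑[ d < n ] (avoid c d + from c d + into c d)
    ≡⟨ sum-cong-≗ (λ c → ∑-distrib-+₃ (avoid c) (from c) (into c)) ⟩
  ∑[ c < n ] (sum (avoid c) + sum (from c) + sum (into c))
    ≡⟨ ∑-distrib-+₃ (sum ∘ avoid) (sum ∘ from) (sum ∘ into) ⟩
  edgesAvoiding G b + ∑[ c < n ] sum (from c) + ∑[ c < n ] sum (into c)
    ≡⟨ cong₂ (λ x y → edgesAvoiding G b + x + y) edges-from-b edges-into-b ⟩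
  edgesAvoiding G b + ∑[ u < n ] E b u + ∑[ u < n ] E u b
    ≡⟨ +-assoc (edgesAvoiding G b) _ _ ⟩
  edgesAvoiding G b + (∑[ u < n ] E b u + ∑[ u < n ] E u b)
    ≡⟨ cong (edgesAvoiding G b +_) (sym (∑-distrib-+ (E b) (λ u → E u b))) ⟩
  edgesAvoiding G b + ∑[ u < n ] (E b u + E u b)
    ≡⟨ cong (edgesAvoiding G b +_) (sum-cong-≗ λ u → sym (adj-split-by-order G b u)) ⟩
  edgesAvoiding G b + deg G b ∎
  where
  open ≡-Reasoning
  avoid E from into : Fin n → Fin n → ℕ
  avoid c d = b2n (c <ᵇ d ∧ b ≠ᵇ c ∧ b ≠ᵇ d ∧ adj G c d)
  E c d = b2n (c <ᵇ d ∧ adj G c d)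
  from c d = ind b c * E c d
  into c d = ind b d * E c d
  edges-from-b : ∑[ c < n ] ∑[ d < n ] (ind b c * E c d) ≡ ∑[ u < n ] E b u
  edges-from-b = trans (sum-cong-≗ λ c → sym (*-distribˡ-sum (ind b c) (E c))) (sum-ind b (λ c → sum (E c)))
  edges-into-b : ∑[ c < n ] ∑[ d < n ] (ind b d * E c d) ≡ ∑[ u < n ] E u b
  edges-into-b = trans (∑-comm into) (trans (sum-cong-≗ λ d → sym (*-distribˡ-sum (ind b d) (λ c → E c d)))
                   (sum-ind b (λ d → ∑[ c < n ] E c d)))

deleteZero : ∀ {n} → Graph (suc n) → Graph n
adj (deleteZero G) i j = adj G (suc i) (suc j)
adj-sym (deleteZero G) i j = adj-sym G (suc i) (suc j)
adj-irrefl (deleteZero G) i = adj-irrefl G (suc i)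

nbrOfZero : ∀ {n} → Graph (suc n) → Fin n → ℕ
nbrOfZero G v = b2n (adj G zero (suc v))

deg-zero : ∀ {n} (G : Graph (suc n)) → deg G zero ≡ sum (nbrOfZero G)
deg-zero G rewrite adj-irrefl G zero = refl

deg-suc : ∀ {n} (G : Graph (suc n)) v → deg G (suc v) ≡ nbrOfZero G v + deg (deleteZero G) v
deg-suc G v rewrite adj-sym G (suc v) zero = refl

edgeCount-deleteZero : ∀ {n} (G : Graph (suc n)) → edgeCount G ≡ sum (nbrOfZero G) + edgeCount (deleteZero G)
edgeCount-deleteZero G = refl

handshake : ∀ {n} (G : Graph n) → degSum G ≡ 2 * edgeCount G
handshake {zero} G = refl
handshake {suc n} G = begin
  deg G zero + ∑[ v < n ] deg G (suc v)
    ≡⟨ cong₂ _+_ (deg-zero G) (trans (sum-cong-≗ (deg-suc G)) (∑-distrib-+ (nbrOfZero G) (deg (deleteZero G)))) ⟩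
  d₀ + (d₀ + degSum (deleteZero G)) ≡⟨ cong (λ s → d₀ + (d₀ + s)) (handshake (deleteZero G)) ⟩
  d₀ + (d₀ + 2 * edgeCount (deleteZero G)) ≡⟨ double d₀ (edgeCount (deleteZero G)) ⟩
  2 * (d₀ + edgeCount (deleteZero G)) ∎
  where
  open ≡-Reasoning
  d₀ = sum (nbrOfZero G)
  double : ∀ a b → a + (a + 2 * b) ≡ 2 * (a + b)
  double = solve-∀

m2Term : ∀ {n} → Graph n → Fin n → Fin n → Fin n → Fin n → ℕ
m2Term G a b c d = b2n (a <ᵇ b ∧ c <ᵇ d ∧ a <ᵇ c ∧ b ≠ᵇ c ∧ b ≠ᵇ d ∧ adj G a b ∧ adj G c d)

m2Count : ∀ {n} → Graph n → ℕ
m2Count {n} G = ∑[ a < n ] ∑[ b < n ] ∑[ c < n ] ∑[ d < n ] m2Term G a b c d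

NM2≡m2Count : ∀ {n} (G : Graph n) → NM2 G ≡ m2Count G
NM2≡m2Count G =
  trans (Σv≡sum λ a → Σv λ b → Σv λ c → Σv (m2Term G a b c)) (sum-cong-≗ λ a →
  trans (Σv≡sum λ b → Σv λ c → Σv (m2Term G a b c)) (sum-cong-≗ λ b →
  trans (Σv≡sum λ c → Σv (m2Term G a b c)) (sum-cong-≗ λ c → Σv≡sum (m2Term G a b c))))

m2Count-deleteZero : ∀ {n} (G : Graph (suc n)) →
  m2Count G ≡ ∑[ b < n ] (nbrOfZero G b * edgesAvoiding (deleteZero G) b) + m2Count (deleteZero G)
m2Count-deleteZero {n} G = cong₂ _+_ pairs-at-zero pairs-off-zero
  where
  open ≡-Reasoning
  G′ = deleteZero G
  pull-adj : ∀ x y z w v → b2n (x ∧ y ∧ z ∧ w ∧ v) ≡ b2n w * b2n (x ∧ y ∧ z ∧ v)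
  pull-adj x y z true v = sym (+-identityʳ _)
  pull-adj true true true false v = refl
  pull-adj true true false false v = refl
  pull-adj true false z false v = refl
  pull-adj false y z false v = refl
  pairs-at-zero : ∑[ b < suc n ] ∑[ c < suc n ] ∑[ d < suc n ] m2Term G zero b c d
                ≡ ∑[ b < n ] (nbrOfZero G b * edgesAvoiding G′ b)
  pairs-at-zero = begin
    ∑[ b < suc n ] ∑[ c < suc n ] ∑[ d < suc n ] m2Term G zero b c d
      ≡⟨ sum-head-zero {f = λ b → ∑[ c < suc n ] ∑[ d < suc n ] m2Term G zero b c d}
                       (sum-zero {suc n} λ c → sum-zero {suc n} λ d → refl) ⟩
    ∑[ b < n ] ∑[ c < suc n ] ∑[ d < suc n ] m2Term G zero (suc b) c d
      ≡⟨ sum-cong-≗ (λ b → trans (sum-head-zero {f = λ c → ∑[ d < suc n ] m2Term G zero (suc b) c d}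
                                                (sum-zero {suc n} λ d → cong b2n (∧-zeroʳ (zero <ᵇ d))))
                                 (sum-cong-≗ λ c → sum-head-zero {f = m2Term G zero (suc b) (suc c)} refl)) ⟩
    ∑[ b < n ] ∑[ c < n ] ∑[ d < n ] m2Term G zero (suc b) (suc c) (suc d)
      ≡⟨ sum-cong-≗ (λ b → trans (sum-cong-≗ λ c → sum-cong-≗ λ d →
                                    pull-adj (c <ᵇ d) (b ≠ᵇ c) (b ≠ᵇ d) _ (adj G′ c d))
                                 (∑∑-scale (nbrOfZero G b) λ c d → b2n (c <ᵇ d ∧ b ≠ᵇ c ∧ b ≠ᵇ d ∧ adj G′ c d))) ⟩
    ∑[ b < n ] (nbrOfZero G b * edgesAvoiding G′ b) ∎
  pairs-off-zero : ∑[ a < n ] ∑[ b < suc n ] ∑[ c < suc n ] ∑[ d < suc n ] m2Term G (suc a) b c d ≡ m2Count G′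
  pairs-off-zero = sum-cong-≗ λ a →
    trans (sum-head-zero {f = λ b → ∑[ c < suc n ] ∑[ d < suc n ] m2Term G (suc a) b c d}
                         (sum-zero {suc n} λ c → sum-zero {suc n} λ d → refl))
    (sum-cong-≗ λ b →
    trans (sum-head-zero {f = λ c → ∑[ d < suc n ] m2Term G (suc a) (suc b) c d}
                         (sum-zero {suc n} λ d → cong b2n (trans (cong (suc a <ᵇ suc b ∧_) (∧-zeroʳ (zero <ᵇ d))) (∧-zeroʳ _))))
    (sum-cong-≗ λ c → sum-head-zero {f = m2Term G (suc a) (suc b) (suc c)} (cong b2n (∧-zeroʳ (suc a <ᵇ suc b)))))

degSqSum-deleteZero : ∀ {n} (G : Graph (suc n)) → let d₀ = sum (nbrOfZero G) in
  degSqSum G ≡ d₀ * d₀ + d₀ + degSqSum (deleteZero G) + 2 * ∑[ v < n ] (nbrOfZero G v * deg (deleteZero G) v)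
degSqSum-deleteZero {n} G = begin
  deg G zero * deg G zero + ∑[ v < n ] (deg G (suc v) * deg G (suc v))
    ≡⟨ cong₂ _+_ (cong₂ _*_ (deg-zero G) (deg-zero G))
         (sum-cong-≗ λ v → trans (cong₂ _*_ (deg-suc G v) (deg-suc G v)) (square-b2n+ (adj G zero (suc v)) (deg G′ v))) ⟩
  d₀ * d₀ + ∑[ v < n ] (deg G′ v * deg G′ v + nbrOfZero G v + 2 * (nbrOfZero G v * deg G′ v))
    ≡⟨ cong (d₀ * d₀ +_) (trans (∑-distrib-+₃ (λ v → deg G′ v * deg G′ v) (nbrOfZero G)
                                               (λ v → 2 * (nbrOfZero G v * deg G′ v)))
         (cong (degSqSum G′ + d₀ +_) (sym (*-distribˡ-sum 2 λ v → nbrOfZero G v * deg G′ v)))) ⟩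
  d₀ * d₀ + (degSqSum G′ + d₀ + 2 * X) ≡⟨ regroup (d₀ * d₀) (degSqSum G′) d₀ (2 * X) ⟩
  d₀ * d₀ + d₀ + degSqSum G′ + 2 * X ∎
  where
  open ≡-Reasoning
  G′ = deleteZero G
  d₀ = sum (nbrOfZero G)
  X = ∑[ v < n ] (nbrOfZero G v * deg G′ v)
  square-b2n+ : ∀ x y → (b2n x + y) * (b2n x + y) ≡ y * y + b2n x + 2 * (b2n x * y)
  square-b2n+ true = solve-∀
  square-b2n+ false y = sym (trans (+-identityʳ _) (+-identityʳ _))
  regroup : ∀ a b c d → a + (b + c + d) ≡ a + c + b + d
  regroup = solve-∀

m2-identity : ∀ {n} (G : Graph n) → 2 * m2Count G + degSqSum G ≡ edgeCount G * edgeCount G + edgeCount G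
m2-identity {zero} G = refl
m2-identity {suc n} G
  rewrite m2Count-deleteZero G | degSqSum-deleteZero G | edgeCount-deleteZero G =
  step (sum A) (sum D) (m2Count G′) (degSqSum G′) (sum (nbrOfZero G)) e′ (m2-identity G′)
       (trans (sym (∑-distrib-+ A D)) (trans (sum-cong-≗ pointwise) (sym (*-distribʳ-sum e′ (nbrOfZero G)))))
  where
  G′ = deleteZero G
  e′ = edgeCount G′
  A D : Fin n → ℕ
  A b = nbrOfZero G b * edgesAvoiding G′ b
  D b = nbrOfZero G b * deg G′ b
  pointwise : ∀ b → A b + D b ≡ nbrOfZero G b * e′
  pointwise b = trans (sym (*-distribˡ-+ (nbrOfZero G b) _ _)) (cong (nbrOfZero G b *_) (sym (edgeCount≡avoiding+deg G′ b)))
  step : ∀ a x m q d e → 2 * m + q ≡ e * e + e → a + x ≡ d * e →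
         2 * (a + m) + (d * d + d + q + 2 * x) ≡ (d + e) * (d + e) + (d + e)
  step a x m q d e hyp₁ hyp₂ = begin
    2 * (a + m) + (d * d + d + q + 2 * x) ≡⟨ regroup a x m q d ⟩
    2 * (a + x) + (2 * m + q) + d * d + d ≡⟨ cong₂ (λ u v → 2 * u + v + d * d + d) hyp₂ hyp₁ ⟩
    2 * (d * e) + (e * e + e) + d * d + d ≡⟨ square d e ⟩
    (d + e) * (d + e) + (d + e) ∎
    where
    open ≡-Reasoning
    regroup : ∀ a x m q d → 2 * (a + m) + (d * d + d + q + 2 * x) ≡ 2 * (a + x) + (2 * m + q) + d * d + d
    regroup = solve-∀
    square : ∀ d e → 2 * (d * e) + (e * e + e) + d * d + d ≡ (d + e) * (d + e) + (d + e)
    square = solve-∀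

nbr-outside : ∀ {n} (G : Graph n) {v} (P : Fin n → Bool) →
  ∑[ w < n ] b2n (P w) < deg G v → ∃[ w ] (adj G v w ≡ true × P w ≡ false)
nbr-outside {n} G {v} P count<deg with sum-pos⇒∃ good good-pos
  where
  good : Fin n → ℕ
  good w = b2n (adj G v w ∧ not (P w))
  split : ∀ w → b2n (adj G v w) ≤ good w + b2n (P w)
  split w with adj G v w | P w
  ... | false | _ = z≤n
  ... | true | false = ≤-refl
  ... | true | true = ≤-refl
  good-pos : 0 < sum good
  good-pos = +-cancelʳ-< (∑[ w < n ] b2n (P w)) 0 (sum good)
    (≤-trans count<deg (≤-trans (sum-mono-≤ split) (≤-reflexive (∑-distrib-+ good (b2n ∘ P)))))
... | w , pos = w , ∧-true-left eq , not-true (∧-true-right eq)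
  where
  eq = b2n-pos pos
  not-true : ∀ {x} → not x ≡ true → x ≡ false
  not-true {false} _ = refl

∃-nbr-≢ : ∀ {n} (G : Graph n) {v} → 2 ≤ deg G v → ∀ u → ∃[ w ] (adj G v w ≡ true × u ≢ w)
∃-nbr-≢ G 2≤d u with nbr-outside G (λ w → does (u ≟ᶠ w)) (≤-trans (≤-reflexive (cong suc (sum-ind-count u))) 2≤d)
... | w , vw , not-u = w , vw , does-false (u ≟ᶠ w) not-u

∃-nbr-≢₂ : ∀ {n} (G : Graph n) {v} → 3 ≤ deg G v → ∀ u x → ∃[ w ] (adj G v w ≡ true × u ≢ w × x ≢ w)
∃-nbr-≢₂ {n} G 3≤d u x with nbr-outside G (λ w → does (u ≟ᶠ w) ∨ does (x ≟ᶠ w)) (≤-trans (s≤s count≤2) 3≤d)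
  where
  count≤2 : ∑[ w < n ] b2n (does (u ≟ᶠ w) ∨ does (x ≟ᶠ w)) ≤ 2
  count≤2 = ≤-trans (sum-mono-≤ λ w → b2n-∨ (does (u ≟ᶠ w)) (does (x ≟ᶠ w)))
              (≤-reflexive (trans (∑-distrib-+ (ind u) (ind x)) (cong₂ _+_ (sum-ind-count u) (sum-ind-count x))))
    where
    b2n-∨ : ∀ p q → b2n (p ∨ q) ≤ b2n p + b2n q
    b2n-∨ true q = s≤s z≤n
    b2n-∨ false q = ≤-refl
... | w , vw , eq = w , vw , does-false (u ≟ᶠ w) (∨-false-left eq) , does-false (x ≟ᶠ w) (∨-false-right eq)
  where
  ∨-false-left : ∀ {p q} → p ∨ q ≡ false → p ≡ false
  ∨-false-left {false} _ = refl
  ∨-false-right : ∀ {p q} → p ∨ q ≡ false → q ≡ false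
  ∨-false-right {false} eq = eq

two-nbrs⇒deg≥2 : ∀ {n} (G : Graph n) {v a b} → adj G v a ≡ true → adj G v b ≡ true → a ≢ b → 2 ≤ deg G v
two-nbrs⇒deg≥2 G {v} {a} {b} va vb a≢b = begin
  2                            ≡⟨ cong₂ _+_ (cong b2n va) (cong b2n vb) ⟨
  A a + A b                    ≡⟨ sum-ind₂ a b A ⟨
  ∑[ w < _ ] ((ind a w + ind b w) * A w) ≤⟨ sum-weighted≤sum _ A (ind-disjoint₂ a≢b) ⟩
  deg G v ∎
  where
  open ≤-Reasoning
  A = λ w → b2n (adj G v w)

three-nbrs⇒deg≥3 : ∀ {n} (G : Graph n) {v a b c} → adj G v a ≡ true → adj G v b ≡ true → adj G v c ≡ true →
                   a ≢ b → a ≢ c → b ≢ c → 3 ≤ deg G v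
three-nbrs⇒deg≥3 G {v} {a} {b} {c} va vb vc a≢b a≢c b≢c = begin
  3                            ≡⟨ cong₂ _+_ (cong₂ _+_ (cong b2n va) (cong b2n vb)) (cong b2n vc) ⟨
  A a + A b + A c              ≡⟨ sum-ind₃ a b c A ⟨
  ∑[ w < _ ] ((ind a w + ind b w + ind c w) * A w) ≤⟨ sum-weighted≤sum _ A (ind-disjoint₃ a≢b a≢c b≢c) ⟩
  deg G v ∎
  where
  open ≤-Reasoning
  A = λ w → b2n (adj G v w)

sum-nbrs-const : ∀ {n} (G : Graph n) u (g : Fin n → ℕ) {c} → (∀ v → adj G u v ≡ true → g v ≡ c) →
  ∑[ v < n ] (b2n (adj G u v) * g v) ≡ deg G u * c
sum-nbrs-const G u g {c} g≡c = trans (sum-cong-≗ pointwise) (sym (*-distribʳ-sum c (λ v → b2n (adj G u v))))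
  where
  pointwise : ∀ v → b2n (adj G u v) * g v ≡ b2n (adj G u v) * c
  pointwise v with adj G u v in uv
  ... | true = cong (_+ 0) (g≡c v uv)
  ... | false = refl

-- The graphs D(3,n)

shift3 : ∀ {n} → Fin n → Fin (3 + n)
shift3 i = suc (suc (suc i))

block-shift3 : ∀ x → (3 + x) / 3 ≡ suc (x / 3)
block-shift3 x = m/n≡1+[m∸n]/n {3 + x} {3} (s≤s (s≤s (s≤s z≤n)))

D3adj-shift3 : ∀ {n} (i j : Fin n) → D3adj (shift3 i) (shift3 j) ≡ D3adj i j
D3adj-shift3 i j = cong (i ≠ᵇ j ∧_) (same-block (toℕ i) (toℕ j))
  where
  same-block : ∀ x y → does (((3 + x) / 3) ≟ℕ ((3 + y) / 3)) ≡ does ((x / 3) ≟ℕ (y / 3))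
  same-block x y rewrite block-shift3 x | block-shift3 y = refl

shift3-block≢0 : ∀ {n} (i : Fin n) → does (((3 + toℕ i) / 3) ≟ℕ 0) ≡ false
shift3-block≢0 i rewrite block-shift3 (toℕ i) = refl

D3adj-block₀-shift3 : ∀ n (k : Fin 3) (u : Fin n) → D3adj (k ↑ˡ n) (shift3 u) ≡ false
D3adj-block₀-shift3 n k u = trans (adj-sym (D3 (3 + n)) (k ↑ˡ n) (shift3 u)) (shifted-to-first k)
  where
  shifted-to-first : ∀ k → D3adj (shift3 u) (k ↑ˡ n) ≡ false
  shifted-to-first zero = shift3-block≢0 u
  shifted-to-first (suc zero) = shift3-block≢0 u
  shifted-to-first (suc (suc zero)) = shift3-block≢0 u

deg-D3-first : ∀ n (k : Fin 3) → deg (D3 (3 + n)) (k ↑ˡ n) ≡ 2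
deg-D3-first n zero = cong (2 +_) (sum-zero λ u → cong b2n (D3adj-block₀-shift3 n zero u))
deg-D3-first n (suc zero) = cong (2 +_) (sum-zero λ u → cong b2n (D3adj-block₀-shift3 n (suc zero) u))
deg-D3-first n (suc (suc zero)) = cong (2 +_) (sum-zero λ u → cong b2n (D3adj-block₀-shift3 n (suc (suc zero)) u))

deg-D3-shift3 : ∀ n (v : Fin n) → deg (D3 (3 + n)) (shift3 v) ≡ deg (D3 n) v
deg-D3-shift3 n v rewrite shift3-block≢0 v = sum-cong-≗ λ u → cong b2n (D3adj-shift3 v u)

d3Edges : ℕ → ℕ
d3Edges 0 = 0
d3Edges 1 = 0
d3Edges 2 = 1
d3Edges (suc (suc (suc m))) = 3 + d3Edges m

d3DegSqSum : ℕ → ℕ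
d3DegSqSum 0 = 0
d3DegSqSum 1 = 0
d3DegSqSum 2 = 2
d3DegSqSum (suc (suc (suc m))) = 12 + d3DegSqSum m

degSum-D3 : ∀ n → degSum (D3 n) ≡ 2 * d3Edges n
degSum-D3 0 = refl
degSum-D3 1 = refl
degSum-D3 2 = refl
degSum-D3 (suc (suc (suc n))) =
  trans (cong₂ _+_ (deg-D3-first n zero) (cong₂ _+_ (deg-D3-first n (suc zero)) (cong₂ _+_ (deg-D3-first n (suc (suc zero)))
    (trans (sum-cong-≗ (deg-D3-shift3 n)) (degSum-D3 n)))))
    (sym (*-distribˡ-+ 2 3 (d3Edges n)))

degSqSum-D3 : ∀ n → degSqSum (D3 n) ≡ d3DegSqSum n
degSqSum-D3 0 = refl
degSqSum-D3 1 = refl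
degSqSum-D3 2 = refl
degSqSum-D3 (suc (suc (suc n))) =
  cong₂ _+_ (square (deg-D3-first n zero)) (cong₂ _+_ (square (deg-D3-first n (suc zero)))
    (cong₂ _+_ (square (deg-D3-first n (suc (suc zero))))
    (trans (sum-cong-≗ λ v → square (deg-D3-shift3 n v)) (degSqSum-D3 n))))
  where
  square : ∀ {x y} → x ≡ y → x * x ≡ y * y
  square x≡y = cong₂ _*_ x≡y x≡y

edgeCount-D3 : ∀ n → edgeCount (D3 n) ≡ d3Edges n
edgeCount-D3 n = *-cancelˡ-≡ _ _ 2 (trans (sym (handshake (D3 n))) (degSum-D3 n))

deg-D3≤2 : ∀ n (v : Fin n) → deg (D3 n) v ≤ 2
deg-D3≤2 1 zero = z≤n
deg-D3≤2 2 zero = s≤s z≤n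
deg-D3≤2 2 (suc zero) = s≤s z≤n
deg-D3≤2 (suc (suc (suc n))) zero = ≤-reflexive (deg-D3-first n zero)
deg-D3≤2 (suc (suc (suc n))) (suc zero) = ≤-reflexive (deg-D3-first n (suc zero))
deg-D3≤2 (suc (suc (suc n))) (suc (suc zero)) = ≤-reflexive (deg-D3-first n (suc (suc zero)))
deg-D3≤2 (suc (suc (suc n))) (suc (suc (suc v))) = ≤-trans (≤-reflexive (deg-D3-shift3 n v)) (deg-D3≤2 n v)

D3adj⇒same-block : ∀ {n} {i j : Fin n} → D3adj i j ≡ true → toℕ i / 3 ≡ toℕ j / 3
D3adj⇒same-block {i = i} {j} eq = does-true (toℕ i / 3 ≟ℕ toℕ j / 3) (∧-true-right eq)

same-block⇒D3adj : ∀ {n} {i j : Fin n} → i ≢ j → toℕ i / 3 ≡ toℕ j / 3 → D3adj i j ≡ true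
same-block⇒D3adj {i = i} {j} i≢j same = cong₂ _∧_ (≠ᵇ-true i≢j) (dec-true (toℕ i / 3 ≟ℕ toℕ j / 3) same)

D3-P4Free : ∀ n → P4Free (D3 n)
D3-P4Free n (a , b , c , d , _ , a≢c , a≢d , b≢c , b≢d , c≢d , ab , bc , cd) =
  <-irrefl refl (≤-trans (three-nbrs⇒deg≥3 (D3 n) {b} (trans (adj-sym (D3 n) b a) ab) bc bd a≢c a≢d c≢d) (deg-D3≤2 n b))
  where
  bd : D3adj b d ≡ true
  bd = same-block⇒D3adj b≢d (trans (D3adj⇒same-block {i = b} bc) (D3adj⇒same-block {i = c} cd))

3*suc : ∀ t m → 3 * suc t + m ≡ suc (suc (suc (3 * t + m)))
3*suc t m = shift t m
  where
  shift : ∀ t m → 3 * (1 + t) + m ≡ 3 + (3 * t + m)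
  shift = solve-∀

d3Edges-shift : ∀ t m → d3Edges (3 * t + m) ≡ 3 * t + d3Edges m
d3Edges-shift zero m = refl
d3Edges-shift (suc t) m rewrite 3*suc t m | d3Edges-shift t m = regroup t (d3Edges m)
  where
  regroup : ∀ t e → 3 + (3 * t + e) ≡ 3 * (1 + t) + e
  regroup = solve-∀

d3DegSqSum-shift : ∀ t m → d3DegSqSum (3 * t + m) ≡ 12 * t + d3DegSqSum m
d3DegSqSum-shift zero m = refl
d3DegSqSum-shift (suc t) m rewrite 3*suc t m | d3DegSqSum-shift t m = regroup t (d3DegSqSum m)
  where
  regroup : ∀ t q → 12 + (12 * t + q) ≡ 12 * (1 + t) + q
  regroup = solve-∀

≤d3Edges+1 : ∀ m → m ≤ d3Edges m + 1
≤d3Edges+1 0 = z≤n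
≤d3Edges+1 1 = ≤-refl
≤d3Edges+1 2 = ≤-refl
≤d3Edges+1 (suc (suc (suc m))) = s≤s (s≤s (s≤s (≤d3Edges+1 m)))

d3-small : ∀ m → m ≤ 4 → d3Edges m * d3Edges m + d3Edges m ≡ d3DegSqSum m
d3-small 0 _ = refl
d3-small 1 _ = refl
d3-small 2 _ = refl
d3-small 3 _ = refl
d3-small 4 _ = refl
d3-small (suc (suc (suc (suc (suc _))))) (s≤s (s≤s (s≤s (s≤s ()))))

d3-large : ∀ m → 5 ≤ m → m * m + 4 + d3DegSqSum m ≤ d3Edges m * d3Edges m + d3Edges m + 5 * m
d3-large 5 _ = m≤m+n 43 2
d3-large 6 _ = m≤m+n 64 8
d3-large 7 _ = ≤-refl
d3-large (suc (suc (suc m@(suc (suc (suc (suc (suc _)))))))) _ = begin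
  (3 + m) * (3 + m) + 4 + (12 + d3DegSqSum m)   ≡⟨ lhs m (d3DegSqSum m) ⟩
  (m * m + 4 + d3DegSqSum m) + (6 * m + 21)
    ≤⟨ +-mono-≤ (d3-large m (s≤s (s≤s (s≤s (s≤s (s≤s z≤n)))))) (+-monoˡ-≤ 21 (*-monoʳ-≤ 6 (≤d3Edges+1 m))) ⟩
  (e * e + e + 5 * m) + (6 * (e + 1) + 21)      ≡⟨ rhs m e ⟩
  (3 + e) * (3 + e) + (3 + e) + 5 * (3 + m) ∎
  where
  open ≤-Reasoning
  e = d3Edges m
  lhs : ∀ m q → (3 + m) * (3 + m) + 4 + (12 + q) ≡ (m * m + 4 + q) + (6 * m + 21)
  lhs = solve-∀
  rhs : ∀ m e → (e * e + e + 5 * m) + (6 * (e + 1) + 21) ≡ (3 + e) * (3 + e) + (3 + e) + 5 * (3 + m)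
  rhs = solve-∀
d3-large (suc (suc (suc (suc zero)))) (s≤s (s≤s (s≤s (s≤s ()))))
d3-large (suc (suc (suc zero))) (s≤s (s≤s (s≤s ())))
d3-large (suc (suc zero)) (s≤s (s≤s ()))
d3-large (suc zero) (s≤s ())

triangle : ∀ {n} → Graph n → Fin n → Fin n → Fin n → ℕ
triangle G v a b = b2n (adj G v a) * b2n (adj G v b) * b2n (adj G a b)

trianglesAt : ∀ {n} → Graph n → Fin n → ℕ
trianglesAt {n} G v = ∑[ a < n ] ∑[ b < n ] (lt a b * triangle G v a b)

triangleCount : ∀ {n} → Graph n → ℕ
triangleCount {n} G = ∑[ v < n ] ∑[ a < n ] ∑[ b < n ] (lt v a * lt a b * triangle G v a b)

triangle-swap : ∀ {n} (G : Graph n) v a b → triangle G v a b ≡ triangle G a v b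
triangle-swap G v a b rewrite adj-sym G v a = reorder (b2n (adj G a v)) (b2n (adj G v b)) (b2n (adj G a b))
  where
  reorder : ∀ x y z → x * y * z ≡ x * z * y
  reorder = solve-∀

triangle-rotate : ∀ {n} (G : Graph n) v a b → triangle G v a b ≡ triangle G a b v
triangle-rotate G v a b rewrite adj-sym G v a | adj-sym G v b = reorder (b2n (adj G a v)) (b2n (adj G b v)) (b2n (adj G a b))
  where
  reorder : ∀ x y z → x * y * z ≡ z * x * y
  reorder = solve-∀

triangle-degenerate₁ : ∀ {n} (G : Graph n) v b → triangle G v v b ≡ 0
triangle-degenerate₁ G v b rewrite adj-irrefl G v = refl

triangle-degenerate₂ : ∀ {n} (G : Graph n) v a → triangle G v a v ≡ 0
triangle-degenerate₂ G v a rewrite adj-irrefl G v = cong (_* b2n (adj G a v)) (*-zeroʳ (b2n (adj G v a)))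

lt-by-position : ∀ {n} (G : Graph n) v a b →
  lt a b * triangle G v a b ≡ (lt v a * lt a b + lt a v * lt v b + lt a b * lt b v) * triangle G v a b
lt-by-position G v a b with v ≟ᶠ a | v ≟ᶠ b
... | yes refl | _ = *-zero-factor (lt v b) (lt v v * lt v b + lt v v * lt v b + lt v b * lt b v) (triangle-degenerate₁ G v b)
... | no _ | yes refl = *-zero-factor (lt a v) (lt v a * lt a v + lt a v * lt v v + lt a v * lt v v) (triangle-degenerate₂ G v a)
... | no v≢a | no v≢b = cong (_* triangle G v a b) (lt-between v≢a v≢b)

sum-trianglesAt : ∀ {n} (G : Graph n) → ∑[ v < n ] trianglesAt G v ≡ 3 * triangleCount G
sum-trianglesAt {n} G = begin
  ∑[ v < n ] trianglesAt G v
    ≡⟨ sum-cong-≗ (λ v → sum-cong-≗ λ a → sum-cong-≗ λ b → trans (lt-by-position G v a b)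
                                          (distrib₃ (lt v a * lt a b) (lt a v * lt v b) (lt a b * lt b v) (triangle G v a b))) ⟩
  ∑[ v < n ] ∑[ a < n ] ∑[ b < n ] (T₁ v a b + T₂ v a b + T₃ v a b)
    ≡⟨ sum-cong-≗ (λ v → trans (sum-cong-≗ λ a → ∑-distrib-+₃ (T₁ v a) (T₂ v a) (T₃ v a))
                              (∑-distrib-+₃ (λ a → sum (T₁ v a)) (λ a → sum (T₂ v a)) (λ a → sum (T₃ v a)))) ⟩
  ∑[ v < n ] (∑[ a < n ] sum (T₁ v a) + ∑[ a < n ] sum (T₂ v a) + ∑[ a < n ] sum (T₃ v a))
    ≡⟨ ∑-distrib-+₃ (λ v → ∑[ a < n ] sum (T₁ v a)) (λ v → ∑[ a < n ] sum (T₂ v a))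
                    (λ v → ∑[ a < n ] sum (T₃ v a)) ⟩
  triangleCount G + ∑[ v < n ] ∑[ a < n ] sum (T₂ v a) + ∑[ v < n ] ∑[ a < n ] sum (T₃ v a)
    ≡⟨ cong₂ (λ x y → triangleCount G + x + y) v-middle v-largest ⟩
  triangleCount G + triangleCount G + triangleCount G
    ≡⟨ thrice (triangleCount G) ⟩
  3 * triangleCount G ∎
  where
  open ≡-Reasoning
  T₁ T₂ T₃ : Fin n → Fin n → Fin n → ℕ
  T₁ v a b = lt v a * lt a b * triangle G v a b
  T₂ v a b = lt a v * lt v b * triangle G v a b
  T₃ v a b = lt a b * lt b v * triangle G v a b
  distrib₃ : ∀ p q r t → (p + q + r) * t ≡ p * t + q * t + r * t
  distrib₃ = solve-∀
  thrice : ∀ t → t + t + t ≡ 3 * t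
  thrice = solve-∀
  v-middle : ∑[ v < n ] ∑[ a < n ] sum (T₂ v a) ≡ triangleCount G
  v-middle = trans (∑-comm (λ v a → sum (T₂ v a)))
    (sum-cong-≗ λ a → sum-cong-≗ λ v → sum-cong-≗ λ b → cong (lt a v * lt v b *_) (triangle-swap G v a b))
  v-largest : ∑[ v < n ] ∑[ a < n ] sum (T₃ v a) ≡ triangleCount G
  v-largest = trans (∑-comm (λ v a → sum (T₃ v a))) (sum-cong-≗ λ a → trans (∑-comm (λ v b → T₃ v a b))
    (sum-cong-≗ λ b → sum-cong-≗ λ v → cong (lt a b * lt b v *_) (triangle-rotate G v a b)))

ordered-triangle⇒trianglesAt>0 : ∀ {n} (G : Graph n) {v a b} →
  adj G v a ≡ true → adj G v b ≡ true → adj G a b ≡ true → a <ᵇ b ≡ true → 0 < trianglesAt G v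
ordered-triangle⇒trianglesAt>0 {n} G {v} {a} {b} va vb ab a<b =
  ≤-trans (≤-reflexive (sym (cong₂ _*_ (cong b2n a<b) (cong₂ _*_ (cong₂ _*_ (cong b2n va) (cong b2n vb)) (cong b2n ab)))))
    (≤-trans (term≤sum (λ y → lt a y * triangle G v a y) b)
             (term≤sum (λ x → ∑[ y < n ] (lt x y * triangle G v x y)) a))

triangle⇒trianglesAt>0 : ∀ {n} (G : Graph n) {v a b} →
  adj G v a ≡ true → adj G v b ≡ true → adj G a b ≡ true → 0 < trianglesAt G v
triangle⇒trianglesAt>0 G {v} {a} {b} va vb ab with <-cmp (toℕ a) (toℕ b)
... | tri< a<b _ _ = ordered-triangle⇒trianglesAt>0 G va vb ab (<ᵇ-true {i = a} a<b)
... | tri≈ _ a≡b _ = ⊥-elim (adj⇒≢ G ab (toℕ-injective a≡b))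
... | tri> _ _ b<a = ordered-triangle⇒trianglesAt>0 G vb va (trans (adj-sym G b a) ab) (<ᵇ-true {i = b} b<a)

triangle-pos : ∀ {n} (G : Graph n) {v a b} → 0 < triangle G v a b →
  adj G v a ≡ true × adj G v b ≡ true × adj G a b ≡ true
triangle-pos G {v} {a} {b} pos with adj G v a | adj G v b | adj G a b
triangle-pos G pos | true | true | true = refl , refl , refl
triangle-pos G () | true | true | false
triangle-pos G () | true | false | _
triangle-pos G () | false | _ | _

trianglesAt>0⇒triangle : ∀ {n} (G : Graph n) {v} → 0 < trianglesAt G v →
  ∃[ a ] ∃[ b ] (adj G v a ≡ true × adj G v b ≡ true × adj G a b ≡ true)
trianglesAt>0⇒triangle {n} G {v} pos with sum-pos⇒∃ (λ a → ∑[ b < n ] (lt a b * triangle G v a b)) pos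
... | a , pos-a with sum-pos⇒∃ (λ b → lt a b * triangle G v a b) pos-a
...   | b , pos-ab = a , b , triangle-pos G (m*n>0⇒n>0 (lt a b) pos-ab)

-- Degree classes and P₄-free graphs

is0 is1 is2 is≥3 large : ℕ → ℕ
is0 0 = 1
is0 _ = 0
is1 1 = 1
is1 _ = 0
is2 2 = 1
is2 _ = 0
is≥3 (suc (suc (suc _))) = 1
is≥3 _ = 0
large x@(suc (suc (suc _))) = x
large _ = 0

is≥2 : ℕ → ℕ
is≥2 x = is2 x + is≥3 x

classes-count : ∀ x → is0 x + is1 x + is2 x + is≥3 x ≡ 1
classes-count 0 = refl
classes-count 1 = refl
classes-count 2 = refl
classes-count (suc (suc (suc _))) = refl

classes-sum : ∀ x → is1 x + 2 * is2 x + large x ≡ x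
classes-sum 0 = refl
classes-sum 1 = refl
classes-sum 2 = refl
classes-sum (suc (suc (suc _))) = refl

classes-square : ∀ x → is1 x + 4 * is2 x + large x * large x ≡ x * x
classes-square 0 = refl
classes-square 1 = refl
classes-square 2 = refl
classes-square (suc (suc (suc _))) = refl

is≥2+is1 : ∀ x → 1 ≤ x → is≥2 x + is1 x ≡ 1
is≥2+is1 1 _ = refl
is≥2+is1 2 _ = refl
is≥2+is1 (suc (suc (suc _))) _ = refl

is1-of-≥2 : ∀ x → 2 ≤ x → is1 x ≡ 0
is1-of-≥2 (suc (suc _)) _ = refl
is1-of-≥2 1 (s≤s ())

3*large≤large² : ∀ x → 3 * large x ≤ large x * large x
3*large≤large² 0 = z≤n
3*large≤large² 1 = z≤n
3*large≤large² 2 = z≤n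
3*large≤large² (suc (suc (suc x))) = *-monoˡ-≤ (3 + x) (m≤m+n 3 x)

3*is≥3≤large : ∀ x → 3 * is≥3 x ≤ large x
3*is≥3≤large 0 = z≤n
3*is≥3≤large 1 = z≤n
3*is≥3≤large 2 = z≤n
3*is≥3≤large (suc (suc (suc x))) = s≤s (s≤s (s≤s z≤n))

is≥3≡0⇒large≡0 : ∀ x → is≥3 x ≡ 0 → large x ≡ 0
is≥3≡0⇒large≡0 0 _ = refl
is≥3≡0⇒large≡0 1 _ = refl
is≥3≡0⇒large≡0 2 _ = refl

leaf-nbr-class : ∀ {n} (G : Graph n) v →
  is1 (deg G v) * ∑[ u < n ] (b2n (adj G v u) * (is≥2 (deg G u) + is1 (deg G u))) ≡ is1 (deg G v)
leaf-nbr-class G v with deg G v in dv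
... | 0 = refl
... | suc (suc _) = refl
... | 1 = trans (+-identityʳ _) (trans (sum-nbrs-const G v _ λ u vu → is≥2+is1 (deg G u) (adj⇒deg≥1 G vu)) (cong (_* 1) dv))

-- The part of a P₄-free graph outside its triangles consists of isolated vertices,
-- cherries (paths with two edges), isolated edges and stars with at least three
-- leaves; stars counts the latter and starLeaves their leaves.
record Census : Set where
  constructor mkCensus
  field
    triangles isolated cherries isolatedEdges stars starLeaves : ℕ
    3*stars≤starLeaves : 3 * stars ≤ starLeaves
    no-stars⇒no-starLeaves : stars ≡ 0 → starLeaves ≡ 0

  restVertices restEdges restDegSqBound components shortPaths : ℕ
  restVertices = isolated + 3 * cherries + starLeaves + 2 * isolatedEdges + stars
  restEdges = 2 * cherries + starLeaves + isolatedEdges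
  restDegSqBound = 6 * cherries + 4 * starLeaves + 2 * isolatedEdges
  components = isolated + cherries + stars + isolatedEdges
  shortPaths = cherries + isolatedEdges

  vertices edges degSqLowerBound : ℕ
  vertices = 3 * triangles + restVertices
  edges = 3 * triangles + restEdges
  degSqLowerBound = 12 * triangles + restDegSqBound

  RestExcessAtMost : ℕ → Set
  RestExcessAtMost s = restEdges * restEdges + restEdges ≤ restDegSqBound + s

module P4FreeStructure {n} (G : Graph n) (free : P4Free G) where

  no-P4 : ∀ {a b c d} → adj G a b ≡ true → adj G b c ≡ true → adj G c d ≡ true → a ≢ c → b ≢ d → a ≢ d → ⊥
  no-P4 {a} {b} {c} {d} ab bc cd a≢c b≢d a≢d =
    free (a , b , c , d , adj⇒≢ G ab , a≢c , a≢d , adj⇒≢ G bc , b≢d , adj⇒≢ G cd , ab , bc , cd)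

  leaf-unless-deg≥2 : ∀ {u v} → adj G u v ≡ true → ¬ 2 ≤ deg G v → deg G v ≡ 1
  leaf-unless-deg≥2 uv ¬2≤dv = ≤-antisym (≤-pred (≰⇒> ¬2≤dv)) (adj⇒deg≥1 G uv)

  nbr-of-deg≥3-is-leaf : ∀ {u v} → 3 ≤ deg G u → adj G u v ≡ true → deg G v ≡ 1
  nbr-of-deg≥3-is-leaf {u} {v} 3≤du uv = leaf-unless-deg≥2 uv λ 2≤dv →
    let (w , vw , u≢w) = ∃-nbr-≢ G 2≤dv u
        (z , uz , v≢z , w≢z) = ∃-nbr-≢₂ G 3≤du v w
    in no-P4 (adj-swap G uz) uv vw (≢-sym v≢z) u≢w (≢-sym w≢z)

  triangle-closed : ∀ {v x y w} → adj G v x ≡ true → adj G v y ≡ true → adj G x y ≡ true →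
                    adj G v w ≡ true → w ≡ x ⊎ w ≡ y
  triangle-closed {v} {x} {y} {w} vx vy xy vw with w ≟ᶠ x | w ≟ᶠ y
  ... | yes w≡x | _ = inj₁ w≡x
  ... | no _ | yes w≡y = inj₂ w≡y
  ... | no w≢x | no w≢y = ⊥-elim (no-P4 (adj-swap G vw) vx xy w≢x (adj⇒≢ G vy) w≢y)

  triangle-nbrs : ∀ {v x y} → adj G v x ≡ true → adj G v y ≡ true → adj G x y ≡ true →
                  ∀ w → b2n (adj G v w) ≡ ind x w + ind y w
  triangle-nbrs {v} {x} {y} vx vy xy w with adj G v w in vw
  ... | true with triangle-closed vx vy xy vw
  ...   | inj₁ refl = sym (cong₂ _+_ (ind-self x) (ind-≢ (≢-sym (adj⇒≢ G xy))))
  ...   | inj₂ refl = sym (cong₂ _+_ (ind-≢ (adj⇒≢ G xy)) (ind-self y))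
  triangle-nbrs {v} {x} {y} vx vy xy w | false = sym (cong₂ _+_ (ind-≢ (nbr-≢ vx)) (ind-≢ (nbr-≢ vy)))
    where
    nbr-≢ : ∀ {z} → adj G v z ≡ true → z ≢ w
    nbr-≢ vz refl with () ← trans (sym vz) vw

  sum-over-triangle-nbrs : ∀ {v x y} → adj G v x ≡ true → adj G v y ≡ true → adj G x y ≡ true →
    ∀ (f : Fin n → ℕ) → ∑[ w < n ] (b2n (adj G v w) * f w) ≡ f x + f y
  sum-over-triangle-nbrs vx vy xy f =
    trans (sum-cong-≗ λ w → cong (_* f w) (triangle-nbrs vx vy xy w)) (sum-ind₂ _ _ f)

  triangle⇒deg≡2 : ∀ {v x y} → adj G v x ≡ true → adj G v y ≡ true → adj G x y ≡ true → deg G v ≡ 2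
  triangle⇒deg≡2 {v} vx vy xy =
    trans (sum-cong-≗ λ w → sym (*-identityʳ (b2n (adj G v w)))) (sum-over-triangle-nbrs vx vy xy λ _ → 1)

  triangle⇒trianglesAt≡1 : ∀ {v x y} → adj G v x ≡ true → adj G v y ≡ true → adj G x y ≡ true → trianglesAt G v ≡ 1
  triangle⇒trianglesAt≡1 {v} {x} {y} vx vy xy = begin
    trianglesAt G v
      ≡⟨ sum-cong-≗ (λ a → trans (sum-cong-≗ λ b → regroup (lt a b) (A a) (A b) (b2n (adj G a b)))
                                 (sym (*-distribˡ-sum (A a) λ b → A b * h a b))) ⟩
    ∑[ a < n ] (A a * ∑[ b < n ] (A b * h a b))
      ≡⟨ sum-over-triangle-nbrs vx vy xy (λ a → ∑[ b < n ] (A b * h a b)) ⟩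
    ∑[ b < n ] (A b * h x b) + ∑[ b < n ] (A b * h y b)
      ≡⟨ cong₂ _+_ (sum-over-triangle-nbrs vx vy xy (h x)) (sum-over-triangle-nbrs vx vy xy (h y)) ⟩
    (h x x + h x y) + (h y x + h y y)
      ≡⟨ cong₂ (λ p q → (p + h x y) + (h y x + q)) (cong (_* _) (lt-irrefl x)) (cong (_* _) (lt-irrefl y)) ⟩
    h x y + (h y x + 0)
      ≡⟨ cong₂ (λ p q → p + (q + 0)) (cong (λ z → lt x y * b2n z) xy) (cong (λ z → lt y x * b2n z) (adj-swap G xy)) ⟩
    lt x y * 1 + (lt y x * 1 + 0)
      ≡⟨ cong₂ _+_ (*-identityʳ (lt x y)) (trans (+-identityʳ _) (*-identityʳ (lt y x))) ⟩
    lt x y + lt y x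
      ≡⟨ lt-connex (adj⇒≢ G xy) ⟩
    1 ∎
    where
    open ≡-Reasoning
    A : Fin n → ℕ
    A w = b2n (adj G v w)
    h : Fin n → Fin n → ℕ
    h a b = lt a b * b2n (adj G a b)
    regroup : ∀ l p q r → l * (p * q * r) ≡ p * (q * (l * r))
    regroup = solve-∀

  trianglesAt≡0⊎1 : ∀ v → trianglesAt G v ≡ 0 ⊎ (trianglesAt G v ≡ 1 × deg G v ≡ 2)
  trianglesAt≡0⊎1 v with trianglesAt G v in eq
  ... | zero = inj₁ refl
  ... | suc _ with trianglesAt>0⇒triangle G (subst (0 <_) (sym eq) (s≤s z≤n))
  ...   | x , y , vx , vy , xy = inj₂ (trans (sym eq) (triangle⇒trianglesAt≡1 vx vy xy) , triangle⇒deg≡2 vx vy xy)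

  nbr-of-deg2-off-triangle-is-leaf : ∀ {u v} → deg G u ≡ 2 → trianglesAt G u ≡ 0 → adj G u v ≡ true → deg G v ≡ 1
  nbr-of-deg2-off-triangle-is-leaf {u} {v} du≡2 no-triangle uv = leaf-unless-deg≥2 uv branching
    where
    branching : ¬ 2 ≤ deg G v
    branching 2≤dv with ∃-nbr-≢ G 2≤dv u | ∃-nbr-≢ G (≤-reflexive (sym du≡2)) v
    ... | w , vw , u≢w | z , uz , v≢z with w ≟ᶠ z
    ...   | yes refl = <-irrefl (sym no-triangle) (triangle⇒trianglesAt>0 G uv uz vw)
    ...   | no w≢z = no-P4 (adj-swap G uz) uv vw (≢-sym v≢z) u≢w (≢-sym w≢z)

  nbr-of-triangle-vertex-has-deg≥2 : ∀ {u v} → 0 < trianglesAt G u → adj G u v ≡ true → 2 ≤ deg G v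
  nbr-of-triangle-vertex-has-deg≥2 {u} {v} pos uv with trianglesAt>0⇒triangle G pos
  ... | x , y , ux , uy , xy with triangle-closed ux uy xy uv
  ...   | inj₁ refl = two-nbrs⇒deg≥2 G (adj-swap G ux) xy (adj⇒≢ G uy)
  ...   | inj₂ refl = two-nbrs⇒deg≥2 G (adj-swap G uy) (adj-swap G xy) (adj⇒≢ G ux)

  leafNbrs : Fin n → ℕ
  leafNbrs u = ∑[ v < n ] (b2n (adj G u v) * is1 (deg G v))

  -- A vertex of degree ≥ 2 is the centre of a star or a cherry, or lies on a triangle.
  leafNbrs-of-deg≥2 : ∀ u → is≥2 (deg G u) * leafNbrs u ≡ large (deg G u) + 2 * (is2 (deg G u) * is0 (trianglesAt G u))
  leafNbrs-of-deg≥2 u with deg G u in du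
  ... | 0 = refl
  ... | 1 = refl
  ... | 2 with trianglesAt≡0⊎1 u
  ...   | inj₁ t≡0 rewrite t≡0 = trans (+-identityʳ _)
          (trans (sum-nbrs-const G u _ λ v uv → cong is1 (nbr-of-deg2-off-triangle-is-leaf du t≡0 uv)) (cong (_* 1) du))
  ...   | inj₂ (t≡1 , _) rewrite t≡1 = trans (+-identityʳ _)
          (trans (sum-nbrs-const G u _ λ v uv →
                   is1-of-≥2 _ (nbr-of-triangle-vertex-has-deg≥2 (subst (0 <_) (sym t≡1) (s≤s z≤n)) uv))
                 (*-zeroʳ (deg G u)))
  leafNbrs-of-deg≥2 u | suc (suc (suc k)) = trans (+-identityʳ _)
    (trans (sum-nbrs-const G u _ λ v uv → cong is1 (nbr-of-deg≥3-is-leaf (subst (3 ≤_) (sym du) (s≤s (s≤s (s≤s z≤n)))) uv))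
    (trans (cong (_* 1) du) (trans (*-identityʳ _) (sym (+-identityʳ _)))))

  is2≡trianglesAt+cherry : ∀ v → is2 (deg G v) ≡ trianglesAt G v + is2 (deg G v) * is0 (trianglesAt G v)
  is2≡trianglesAt+cherry v with trianglesAt≡0⊎1 v
  ... | inj₁ t≡0 rewrite t≡0 = sym (*-identityʳ _)
  ... | inj₂ (t≡1 , d≡2) rewrite t≡1 | d≡2 = refl

  isolated leaves degTwo stars starLeaves cherries isolatedEdges : ℕ
  isolated = ∑[ v < n ] is0 (deg G v)
  leaves = ∑[ v < n ] is1 (deg G v)
  degTwo = ∑[ v < n ] is2 (deg G v)
  stars = ∑[ v < n ] is≥3 (deg G v)
  starLeaves = ∑[ v < n ] large (deg G v)
  cherries = ∑[ v < n ] (is2 (deg G v) * is0 (trianglesAt G v))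
  isolatedEdges = ∑[ a < n ] ∑[ b < n ] (lt a b * (is1 (deg G a) * (b2n (adj G a b) * is1 (deg G b))))

  degTwo≡ : degTwo ≡ 3 * triangleCount G + cherries
  degTwo≡ = trans (sum-cong-≗ is2≡trianglesAt+cherry)
    (trans (∑-distrib-+ (trianglesAt G) (λ v → is2 (deg G v) * is0 (trianglesAt G v))) (cong (_+ cherries) (sum-trianglesAt G)))

  leaves-beside-centres : ∑[ v < n ] (is1 (deg G v) * ∑[ u < n ] (b2n (adj G v u) * is≥2 (deg G u))) ≡ starLeaves + 2 * cherries
  leaves-beside-centres = begin
    ∑[ v < n ] (is1 (deg G v) * ∑[ u < n ] (A v u * is≥2 (deg G u)))
      ≡⟨ sum-cong-≗ (λ v → *-distribˡ-sum (is1 (deg G v)) λ u → A v u * is≥2 (deg G u)) ⟩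
    ∑[ v < n ] ∑[ u < n ] (is1 (deg G v) * (A v u * is≥2 (deg G u)))
      ≡⟨ ∑-comm (λ v u → is1 (deg G v) * (A v u * is≥2 (deg G u))) ⟩
    ∑[ u < n ] ∑[ v < n ] (is1 (deg G v) * (A v u * is≥2 (deg G u)))
      ≡⟨ sum-cong-≗ (λ u → sum-cong-≗ λ v → trans (cong (λ x → is1 (deg G v) * (b2n x * is≥2 (deg G u))) (adj-sym G v u))
                                                 (reorder (is1 (deg G v)) (A u v) (is≥2 (deg G u)))) ⟩
    ∑[ u < n ] ∑[ v < n ] (is≥2 (deg G u) * (A u v * is1 (deg G v)))
      ≡⟨ sum-cong-≗ (λ u → sym (*-distribˡ-sum (is≥2 (deg G u)) λ v → A u v * is1 (deg G v))) ⟩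
    ∑[ u < n ] (is≥2 (deg G u) * leafNbrs u)
      ≡⟨ sum-cong-≗ leafNbrs-of-deg≥2 ⟩
    ∑[ u < n ] (large (deg G u) + 2 * cherry u)
      ≡⟨ trans (∑-distrib-+ (λ u → large (deg G u)) (λ u → 2 * cherry u))
               (cong (starLeaves +_) (sym (*-distribˡ-sum 2 cherry))) ⟩
    starLeaves + 2 * cherries ∎
    where
    open ≡-Reasoning
    A : Fin n → Fin n → ℕ
    A v u = b2n (adj G v u)
    cherry : Fin n → ℕ
    cherry u = is2 (deg G u) * is0 (trianglesAt G u)
    reorder : ∀ x y z → x * (y * z) ≡ z * (y * x)
    reorder = solve-∀

  leaves-beside-leaves : ∑[ v < n ] (is1 (deg G v) * leafNbrs v) ≡ 2 * isolatedEdges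
  leaves-beside-leaves =
    trans (sum-cong-≗ λ v → *-distribˡ-sum (is1 (deg G v)) λ u → A v u * is1 (deg G u))
          (sum-symmetric (λ v u → is1 (deg G v) * (A v u * is1 (deg G u))) leaf-edge-sym leaf-edge-diag)
    where
    A : Fin n → Fin n → ℕ
    A v u = b2n (adj G v u)
    leaf-edge-sym : ∀ v u → is1 (deg G v) * (A v u * is1 (deg G u)) ≡ is1 (deg G u) * (A u v * is1 (deg G v))
    leaf-edge-sym v u rewrite adj-sym G v u = reorder (is1 (deg G v)) (A u v) (is1 (deg G u))
      where
      reorder : ∀ x y z → x * (y * z) ≡ z * (y * x)
      reorder = solve-∀
    leaf-edge-diag : ∀ v → is1 (deg G v) * (A v v * is1 (deg G v)) ≡ 0
    leaf-edge-diag v rewrite adj-irrefl G v = *-zeroʳ (is1 (deg G v))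

  leaves≡ : leaves ≡ 2 * cherries + starLeaves + 2 * isolatedEdges
  leaves≡ = begin
    leaves
      ≡⟨ sum-cong-≗ (λ v → sym (leaf-nbr-class G v)) ⟩
    ∑[ v < n ] (is1 (deg G v) * ∑[ u < n ] (A v u * (is≥2 (deg G u) + is1 (deg G u))))
      ≡⟨ sum-cong-≗ (λ v → trans (cong (is1 (deg G v) *_) (split-nbrs v)) (*-distribˡ-+ (is1 (deg G v)) _ _)) ⟩
    ∑[ v < n ] (is1 (deg G v) * ∑[ u < n ] (A v u * is≥2 (deg G u)) + is1 (deg G v) * leafNbrs v)
      ≡⟨ ∑-distrib-+ (λ v → is1 (deg G v) * ∑[ u < n ] (A v u * is≥2 (deg G u))) (λ v → is1 (deg G v) * leafNbrs v) ⟩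
    ∑[ v < n ] (is1 (deg G v) * ∑[ u < n ] (A v u * is≥2 (deg G u))) + ∑[ v < n ] (is1 (deg G v) * leafNbrs v)
      ≡⟨ cong₂ _+_ leaves-beside-centres leaves-beside-leaves ⟩
    starLeaves + 2 * cherries + 2 * isolatedEdges
      ≡⟨ cong (_+ 2 * isolatedEdges) (+-comm starLeaves (2 * cherries)) ⟩
    2 * cherries + starLeaves + 2 * isolatedEdges ∎
    where
    open ≡-Reasoning
    A : Fin n → Fin n → ℕ
    A v u = b2n (adj G v u)
    split-nbrs : ∀ v → ∑[ u < n ] (A v u * (is≥2 (deg G u) + is1 (deg G u)))
                     ≡ ∑[ u < n ] (A v u * is≥2 (deg G u)) + leafNbrs v
    split-nbrs v = trans (sum-cong-≗ λ u → *-distribˡ-+ (A v u) _ _)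
                         (∑-distrib-+ (λ u → A v u * is≥2 (deg G u)) (λ u → A v u * is1 (deg G u)))

  census : Census
  census = record
    { triangles = triangleCount G
    ; isolated = isolated
    ; cherries = cherries
    ; isolatedEdges = isolatedEdges
    ; stars = stars
    ; starLeaves = starLeaves
    ; 3*stars≤starLeaves =
        ≤-trans (≤-reflexive (*-distribˡ-sum 3 λ v → is≥3 (deg G v))) (sum-mono-≤ λ v → 3*is≥3≤large (deg G v))
    ; no-stars⇒no-starLeaves = λ no-stars →
        sum-zero λ v → is≥3≡0⇒large≡0 (deg G v) (sum≡0⇒≡0 (λ v → is≥3 (deg G v)) no-stars v)
    }

  open Census census using (vertices; edges; degSqLowerBound)

  census-vertices : n ≡ vertices
  census-vertices = begin
    n                                          ≡⟨ trans (sym (*-identityʳ n)) (sym (sum-const n 1)) ⟩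
    ∑[ v < n ] 1                               ≡⟨ sum-cong-≗ (λ v → sym (classes-count (deg G v))) ⟩
    ∑[ v < n ] (is0 (deg G v) + is1 (deg G v) + is2 (deg G v) + is≥3 (deg G v))
      ≡⟨ trans (∑-distrib-+ (λ v → is0 (deg G v) + is1 (deg G v) + is2 (deg G v)) (λ v → is≥3 (deg G v)))
               (cong (_+ stars) (∑-distrib-+₃ (λ v → is0 (deg G v)) (λ v → is1 (deg G v)) (λ v → is2 (deg G v)))) ⟩
    isolated + leaves + degTwo + stars         ≡⟨ cong₂ (λ l d → isolated + l + d + stars) leaves≡ degTwo≡ ⟩
    isolated + (2 * cherries + starLeaves + 2 * isolatedEdges) + (3 * triangleCount G + cherries) + stars
      ≡⟨ regroup isolated cherries starLeaves isolatedEdges (triangleCount G) stars ⟩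
    vertices ∎
    where
    open ≡-Reasoning
    regroup : ∀ i c l p t s → i + (2 * c + l + 2 * p) + (3 * t + c) + s ≡ 3 * t + (i + 3 * c + l + 2 * p + s)
    regroup = solve-∀

  census-edges : edgeCount G ≡ edges
  census-edges = *-cancelˡ-≡ _ _ 2 (begin
    2 * edgeCount G                            ≡⟨ handshake G ⟨
    degSum G                                   ≡⟨ sum-cong-≗ (λ v → sym (classes-sum (deg G v))) ⟩
    ∑[ v < n ] (is1 (deg G v) + 2 * is2 (deg G v) + large (deg G v))
      ≡⟨ trans (∑-distrib-+₃ (λ v → is1 (deg G v)) (λ v → 2 * is2 (deg G v)) (λ v → large (deg G v)))
               (cong (λ x → leaves + x + starLeaves) (sym (*-distribˡ-sum 2 λ v → is2 (deg G v)))) ⟩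
    leaves + 2 * degTwo + starLeaves           ≡⟨ cong₂ (λ l d → l + 2 * d + starLeaves) leaves≡ degTwo≡ ⟩
    2 * cherries + starLeaves + 2 * isolatedEdges + 2 * (3 * triangleCount G + cherries) + starLeaves
      ≡⟨ regroup cherries starLeaves isolatedEdges (triangleCount G) ⟩
    2 * edges ∎)
    where
    open ≡-Reasoning
    regroup : ∀ c l p t → 2 * c + l + 2 * p + 2 * (3 * t + c) + l ≡ 2 * (3 * t + (2 * c + l + p))
    regroup = solve-∀

  census-degSq : degSqLowerBound ≤ degSqSum G
  census-degSq = begin
    degSqLowerBound
      ≡⟨ regroup cherries starLeaves isolatedEdges (triangleCount G) ⟩
    2 * cherries + starLeaves + 2 * isolatedEdges + 4 * (3 * triangleCount G + cherries) + 3 * starLeaves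
      ≡⟨ cong₂ (λ l d → l + 4 * d + 3 * starLeaves) leaves≡ degTwo≡ ⟨
    leaves + 4 * degTwo + 3 * starLeaves
      ≤⟨ +-monoʳ-≤ (leaves + 4 * degTwo) (≤-trans (≤-reflexive (*-distribˡ-sum 3 λ v → large (deg G v)))
                                                   (sum-mono-≤ λ v → 3*large≤large² (deg G v))) ⟩
    leaves + 4 * degTwo + ∑[ v < n ] (large (deg G v) * large (deg G v))
      ≡⟨ trans (cong (λ x → leaves + x + ∑[ v < n ] (large (deg G v) * large (deg G v))) (*-distribˡ-sum 4 λ v → is2 (deg G v)))
               (sym (∑-distrib-+₃ (λ v → is1 (deg G v)) (λ v → 4 * is2 (deg G v)) (λ v → large (deg G v) * large (deg G v)))) ⟩
    ∑[ v < n ] (is1 (deg G v) + 4 * is2 (deg G v) + large (deg G v) * large (deg G v))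
      ≡⟨ sum-cong-≗ (λ v → classes-square (deg G v)) ⟩
    degSqSum G ∎
    where
    open ≤-Reasoning
    regroup : ∀ c l p t → 12 * t + (6 * c + 4 * l + 2 * p) ≡ 2 * c + l + 2 * p + 4 * (3 * t + c) + 3 * l
    regroup = solve-∀

-- Comparison with D(3,n)

components-inequality : ∀ X r w → w ≤ r → w ≤ X → 5 ≤ X + r → 1 ≤ r → (r ≡ 1 → w ≡ 0) →
  2 * w + 2 * X + 5 * r ≤ 2 * X * r + r * r + 4
components-inequality X 1 w _ _ _ _ r≡1⇒w≡0 rewrite r≡1⇒w≡0 refl = ≤-reflexive (identity X)
  where
  identity : ∀ X → 2 * 0 + 2 * X + 5 * 1 ≡ 2 * X * 1 + 1 * 1 + 4
  identity = solve-∀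
components-inequality (suc (suc (suc u))) (suc (suc s)) w w≤r _ _ _ _ =
  ≤-trans (+-monoˡ-≤ (5 * (2 + s)) (+-monoˡ-≤ (2 * (3 + u)) (*-monoʳ-≤ 2 w≤r)))
          (≤-by-slack (3 * s + 2 * u + 2 * u * s + s * s) (identity u s))
  where
  identity : ∀ u s → 2 * (2 + s) + 2 * (3 + u) + 5 * (2 + s) + (3 * s + 2 * u + 2 * u * s + s * s)
                   ≡ 2 * (3 + u) * (2 + s) + (2 + s) * (2 + s) + 4
  identity = solve-∀
components-inequality 0 (suc (suc (suc (suc (suc s))))) zero _ _ _ _ _ =
  ≤-by-slack (4 + 5 * s + s * s) (identity s)
  where
  identity : ∀ s → 2 * 0 + 2 * 0 + 5 * (5 + s) + (4 + 5 * s + s * s) ≡ 2 * 0 * (5 + s) + (5 + s) * (5 + s) + 4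
  identity = solve-∀
components-inequality 1 (suc (suc (suc (suc s)))) w _ w≤X _ _ _ =
  ≤-trans (+-monoˡ-≤ (5 * (4 + s)) (+-monoˡ-≤ 2 (*-monoʳ-≤ 2 w≤X)))
          (≤-by-slack (4 + 5 * s + s * s) (identity s))
  where
  identity : ∀ s → 2 * 1 + 2 * 1 + 5 * (4 + s) + (4 + 5 * s + s * s) ≡ 2 * 1 * (4 + s) + (4 + s) * (4 + s) + 4
  identity = solve-∀
components-inequality 2 (suc (suc (suc s))) w _ w≤X _ _ _ =
  ≤-trans (+-monoˡ-≤ (5 * (3 + s)) (+-monoˡ-≤ 4 (*-monoʳ-≤ 2 w≤X)))
          (≤-by-slack (2 + 5 * s + s * s) (identity s))
  where
  identity : ∀ s → 2 * 2 + 2 * 2 + 5 * (3 + s) + (2 + 5 * s + s * s) ≡ 2 * 2 * (3 + s) + (3 + s) * (3 + s) + 4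
  identity = solve-∀
components-inequality X 0 w _ _ _ () _
components-inequality 0 (suc (suc s)) (suc w) _ () _ _ _
components-inequality 0 (suc (suc zero)) zero _ _ (s≤s (s≤s ())) _ _
components-inequality 0 (suc (suc (suc zero))) zero _ _ (s≤s (s≤s (s≤s ()))) _ _
components-inequality 0 (suc (suc (suc (suc zero)))) zero _ _ (s≤s (s≤s (s≤s (s≤s ())))) _ _
components-inequality 1 (suc (suc zero)) w _ _ (s≤s (s≤s (s≤s ()))) _ _
components-inequality 1 (suc (suc (suc zero))) w _ _ (s≤s (s≤s (s≤s (s≤s ())))) _ _
components-inequality 2 (suc (suc zero)) w _ _ (s≤s (s≤s (s≤s (s≤s ())))) _ _

overfull : ∀ {a₀ a₁ a₂ a₃ a₄} n₀ c l p s → a₀ ≤ n₀ → a₁ ≤ c → a₂ ≤ l → a₃ ≤ p → a₄ ≤ s →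
  5 ≤ a₀ + 3 * a₁ + a₂ + 2 * a₃ + a₄ → ¬ n₀ + 3 * c + l + 2 * p + s ≤ 4
overfull _ _ _ _ _ h₀ h₁ h₂ h₃ h₄ 5≤a =
  5≰4 (≤-trans 5≤a (+-mono-≤ (+-mono-≤ (+-mono-≤ (+-mono-≤ h₀ (*-monoʳ-≤ 3 h₁)) h₂) (*-monoʳ-≤ 2 h₃)) h₄))

-- Two disjoint edges are the only small configuration that beats D(3,4).
small-census : (C : Census) → Census.restVertices C ≤ 4 → let open Census C in
  RestExcessAtMost 0 ⊎ (restVertices ≡ 4 × restEdges ≤ 2 × RestExcessAtMost 2)
small-census (mkCensus _ _ _ _ 0 (suc _) _ no-stars⇒no-leaves) _ with () ← no-stars⇒no-leaves refl
small-census (mkCensus _ n₀ 0 0 0 0 _ _) _ = inj₁ z≤n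
small-census (mkCensus _ n₀ 0 1 0 0 _ _) _ = inj₁ ≤-refl
small-census (mkCensus _ 0 0 2 0 0 _ _) _ = inj₂ (refl , ≤-refl , ≤-refl)
small-census (mkCensus _ (suc n₀) 0 2 0 0 _ _) Y≤4 =
  ⊥-elim (overfull (suc n₀) 0 0 2 0 (s≤s z≤n) z≤n z≤n ≤-refl z≤n (m≤m+n 5 _) Y≤4)
small-census (mkCensus _ n₀ 0 (suc (suc (suc p))) 0 0 _ _) Y≤4 =
  ⊥-elim (overfull n₀ 0 0 (3 + p) 0 z≤n z≤n z≤n (s≤s (s≤s (s≤s z≤n))) z≤n (m≤m+n 5 _) Y≤4)
small-census (mkCensus _ n₀ 1 0 0 0 _ _) _ = inj₁ ≤-refl
small-census (mkCensus _ n₀ 1 (suc p) 0 0 _ _) Y≤4 =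
  ⊥-elim (overfull n₀ 1 0 (suc p) 0 z≤n ≤-refl z≤n (s≤s z≤n) z≤n (m≤m+n 5 _) Y≤4)
small-census (mkCensus _ n₀ (suc (suc c)) p 0 0 _ _) Y≤4 =
  ⊥-elim (overfull n₀ (2 + c) 0 p 0 z≤n (s≤s (s≤s z≤n)) z≤n z≤n z≤n (m≤m+n 5 _) Y≤4)
small-census (mkCensus _ n₀ c p (suc (suc s)) l 3s≤l _) Y≤4 =
  ⊥-elim (overfull n₀ c l p (2 + s) z≤n z≤n
                                     (≤-trans (*-monoʳ-≤ 3 (s≤s (s≤s (z≤n {s})))) 3s≤l) z≤n z≤n (m≤m+n 5 _) Y≤4)
small-census (mkCensus _ n₀ c p 1 (suc (suc (suc (suc l)))) _ _) Y≤4 =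
  ⊥-elim (overfull n₀ c (4 + l) p 1 z≤n z≤n (s≤s (s≤s (s≤s (s≤s z≤n)))) z≤n ≤-refl (m≤m+n 5 _) Y≤4)
small-census (mkCensus _ 0 0 0 1 3 _ _) _ = inj₁ ≤-refl
small-census (mkCensus _ (suc n₀) c p 1 3 _ _) Y≤4 =
  ⊥-elim (overfull (suc n₀) c 3 p 1 (s≤s z≤n) z≤n ≤-refl z≤n ≤-refl (m≤m+n 5 _) Y≤4)
small-census (mkCensus _ 0 (suc c) p 1 3 _ _) Y≤4 =
  ⊥-elim (overfull 0 (suc c) 3 p 1 z≤n (s≤s z≤n) ≤-refl z≤n ≤-refl (m≤m+n 5 _) Y≤4)
small-census (mkCensus _ 0 0 (suc p) 1 3 _ _) Y≤4 =
  ⊥-elim (overfull 0 0 3 (suc p) 1 z≤n z≤n ≤-refl (s≤s z≤n) ≤-refl (m≤m+n 5 _) Y≤4)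
small-census (mkCensus _ _ _ _ 1 0 () _) _
small-census (mkCensus _ _ _ _ 1 1 (s≤s ()) _) _
small-census (mkCensus _ _ _ _ 1 2 (s≤s (s≤s ())) _) _

-- The 3t triangle edges and the δ surplus edges of D(3,·) form 3tδ further disjoint
-- pairs, worth 6tδ in 2·N(M₂); they pay for the slack s.
lift-by-triangles : ∀ t X δ q Q s s′ →
  X * X + X + q ≤ (X + δ) * (X + δ) + (X + δ) + Q + s → s ≤ 6 * t * δ + s′ →
  (3 * t + X) * (3 * t + X) + (3 * t + X) + (12 * t + q)
    ≤ (3 * t + (X + δ)) * (3 * t + (X + δ)) + (3 * t + (X + δ)) + (12 * t + Q) + s′
lift-by-triangles t X δ q Q s s′ base slack = begin
  (3 * t + X) * (3 * t + X) + (3 * t + X) + (12 * t + q)    ≡⟨ expand₁ t X q ⟩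
  C + (X * X + X + q)                                       ≤⟨ +-monoʳ-≤ C base ⟩
  C + ((X + δ) * (X + δ) + (X + δ) + Q + s)
    ≤⟨ +-monoʳ-≤ C (+-monoʳ-≤ ((X + δ) * (X + δ) + (X + δ) + Q) slack) ⟩
  C + ((X + δ) * (X + δ) + (X + δ) + Q + (6 * t * δ + s′))  ≡⟨ expand₂ t X δ Q s′ ⟩
  (3 * t + (X + δ)) * (3 * t + (X + δ)) + (3 * t + (X + δ)) + (12 * t + Q) + s′ ∎
  where
  open ≤-Reasoning
  C = 9 * (t * t) + 6 * t * X + 15 * t
  expand₁ : ∀ t X q → (3 * t + X) * (3 * t + X) + (3 * t + X) + (12 * t + q) ≡ 9 * (t * t) + 6 * t * X + 15 * t + (X * X + X + q)
  expand₁ = solve-∀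
  expand₂ : ∀ t X δ Q s′ → 9 * (t * t) + 6 * t * X + 15 * t + ((X + δ) * (X + δ) + (X + δ) + Q + (6 * t * δ + s′))
                         ≡ (3 * t + (X + δ)) * (3 * t + (X + δ)) + (3 * t + (X + δ)) + (12 * t + Q) + s′
  expand₂ = solve-∀

module CensusBounds (C : Census) where
  open Census C

  restVertices≡ : restVertices ≡ restEdges + components
  restVertices≡ = regroup isolated cherries starLeaves isolatedEdges stars
    where
    regroup : ∀ i c l p s → i + 3 * c + l + 2 * p + s ≡ 2 * c + l + p + (i + c + s + p)
    regroup = solve-∀

  restDegSqBound+2*shortPaths : restDegSqBound + 2 * shortPaths ≡ 4 * restEdges
  restDegSqBound+2*shortPaths = regroup cherries starLeaves isolatedEdges
    where
    regroup : ∀ c l p → 6 * c + 4 * l + 2 * p + 2 * (c + p) ≡ 4 * (2 * c + l + p)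
    regroup = solve-∀

  shortPaths≤components : shortPaths ≤ components
  shortPaths≤components = ≤-by-slack (isolated + stars) (regroup isolated cherries stars isolatedEdges)
    where
    regroup : ∀ i c s p → c + p + (i + s) ≡ i + c + s + p
    regroup = solve-∀

  shortPaths≤restEdges : shortPaths ≤ restEdges
  shortPaths≤restEdges = ≤-by-slack (cherries + starLeaves) (regroup cherries starLeaves isolatedEdges)
    where
    regroup : ∀ c l p → c + p + (c + l) ≡ 2 * c + l + p
    regroup = solve-∀

  no-stars⇒restVertices≤3*components : stars ≡ 0 → restVertices ≤ 3 * components
  no-stars⇒restVertices≤3*components no-stars rewrite no-stars⇒no-starLeaves no-stars | no-stars =
    ≤-by-slack (2 * isolated + isolatedEdges) (regroup isolated cherries isolatedEdges)
    where
    regroup : ∀ i c p → i + 3 * c + 0 + 2 * p + 0 + (2 * i + p) ≡ 3 * (i + c + 0 + p)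
    regroup = solve-∀

  stars≤components : stars ≤ components
  stars≤components = ≤-by-slack (isolated + cherries + isolatedEdges) (regroup isolated cherries stars isolatedEdges)
    where
    regroup : ∀ i c s p → s + (i + c + p) ≡ i + c + s + p
    regroup = solve-∀

  components≥1 : 1 ≤ restVertices → 1 ≤ components
  components≥1 1≤Y with components in r
  ... | suc _ = s≤s z≤n
  ... | zero = ⊥-elim (<-irrefl refl
                 (≤-trans 1≤Y (≤-trans (no-stars⇒restVertices≤3*components no-stars) (≤-reflexive (cong (3 *_) r)))))
    where
    no-stars : stars ≡ 0
    no-stars = n≤0⇒n≡0 (≤-trans stars≤components (≤-reflexive r))

  one-component⇒no-shortPaths : 5 ≤ restVertices → components ≡ 1 → shortPaths ≡ 0
  one-component⇒no-shortPaths 5≤Y r≡1 with stars ≟ℕ 0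
  ... | yes no-stars = ⊥-elim (5≰4 5≤Y (≤-trans (no-stars⇒restVertices≤3*components no-stars)
                                                (≤-trans (≤-reflexive (cong (3 *_) r≡1)) (n≤1+n 3))))
  ... | no some-star = n≤0⇒n≡0 (+-cancelʳ-≤ 1 shortPaths 0 (≤-trans (+-monoʳ-≤ shortPaths (n≢0⇒n>0 some-star))
                                                              (≤-trans shortPaths+stars≤components (≤-reflexive r≡1))))
    where
    shortPaths+stars≤components : shortPaths + stars ≤ components
    shortPaths+stars≤components = ≤-by-slack isolated (regroup isolated cherries stars isolatedEdges)
      where
      regroup : ∀ i c s p → c + p + s + i ≡ i + c + s + p
      regroup = solve-∀

  restEdges≤restVertices : restEdges ≤ restVertices
  restEdges≤restVertices = ≤-by-slack components (sym restVertices≡)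

  restEdges≤d3Edges : restEdges ≤ d3Edges restVertices
  restEdges≤d3Edges with restVertices ≟ℕ 0
  ... | yes Y≡0 = ≤-trans restEdges≤restVertices (≤-trans (≤-reflexive Y≡0) z≤n)
  ... | no Y≢0 = +-cancelʳ-≤ 1 restEdges (d3Edges restVertices)
      (≤-trans (+-monoʳ-≤ restEdges (components≥1 (n≢0⇒n>0 Y≢0)))
               (≤-trans (≤-reflexive (sym restVertices≡)) (≤d3Edges+1 restVertices)))

  rest-core : 5 ≤ restVertices → restEdges * restEdges + restEdges + 5 * restVertices ≤ restVertices * restVertices + 4 + restDegSqBound
  rest-core 5≤Y = +-cancelʳ-≤ (2 * shortPaths) _ _ (begin
    X * X + X + 5 * Y + 2 * w             ≡⟨ cong (λ y → X * X + X + 5 * y + 2 * w) restVertices≡ ⟩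
    X * X + X + 5 * (X + r) + 2 * w       ≡⟨ regroup₁ X r w ⟩
    X * X + 4 * X + (2 * w + 2 * X + 5 * r)
      ≤⟨ +-monoʳ-≤ (X * X + 4 * X) (components-inequality X r w shortPaths≤components shortPaths≤restEdges
                                      (subst (5 ≤_) restVertices≡ 5≤Y) (components≥1 (≤-trans (s≤s z≤n) 5≤Y))
                                      (one-component⇒no-shortPaths 5≤Y)) ⟩
    X * X + 4 * X + (2 * X * r + r * r + 4) ≡⟨ regroup₂ X r ⟩
    (X + r) * (X + r) + 4 + 4 * X         ≡⟨ cong₂ (λ y q → y * y + 4 + q) (sym restVertices≡) (sym restDegSqBound+2*shortPaths) ⟩
    Y * Y + 4 + (restDegSqBound + 2 * w)  ≡⟨ +-assoc (Y * Y + 4) restDegSqBound (2 * w) ⟨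
    Y * Y + 4 + restDegSqBound + 2 * w ∎)
    where
    open ≤-Reasoning
    X = restEdges
    Y = restVertices
    r = components
    w = shortPaths
    regroup₁ : ∀ X r w → X * X + X + 5 * (X + r) + 2 * w ≡ X * X + 4 * X + (2 * w + 2 * X + 5 * r)
    regroup₁ = solve-∀
    regroup₂ : ∀ X r → X * X + 4 * X + (2 * X * r + r * r + 4) ≡ (X + r) * (X + r) + 4 + 4 * X
    regroup₂ = solve-∀

  rest-large : 5 ≤ restVertices →
    restEdges * restEdges + restEdges + d3DegSqSum restVertices
      ≤ d3Edges restVertices * d3Edges restVertices + d3Edges restVertices + restDegSqBound
  rest-large 5≤Y = +-cancelʳ-≤ (5 * Y) _ _ (begin
    X * X + X + QQ + 5 * Y             ≡⟨ swap-last (X * X + X) QQ (5 * Y) ⟩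
    (X * X + X + 5 * Y) + QQ           ≤⟨ +-monoˡ-≤ QQ (rest-core 5≤Y) ⟩
    Y * Y + 4 + restDegSqBound + QQ    ≡⟨ swap-last (Y * Y + 4) restDegSqBound QQ ⟩
    Y * Y + 4 + QQ + restDegSqBound    ≤⟨ +-monoˡ-≤ restDegSqBound (d3-large Y 5≤Y) ⟩
    E * E + E + 5 * Y + restDegSqBound ≡⟨ swap-last (E * E + E) (5 * Y) restDegSqBound ⟩
    E * E + E + restDegSqBound + 5 * Y ∎)
    where
    open ≤-Reasoning
    X = restEdges
    Y = restVertices
    E = d3Edges restVertices
    QQ = d3DegSqSum restVertices
    swap-last : ∀ a b c → a + b + c ≡ a + c + b
    swap-last = solve-∀

  RestBound : ℕ → Set
  RestBound s = restEdges * restEdges + restEdges + d3DegSqSum restVertices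
                  ≤ d3Edges restVertices * d3Edges restVertices + d3Edges restVertices + restDegSqBound + s

  small-rest-bound : restVertices ≤ 4 → ∀ s → RestExcessAtMost s → RestBound s
  small-rest-bound Y≤4 s bound = begin
    X * X + X + QQ           ≤⟨ +-monoˡ-≤ QQ bound ⟩
    restDegSqBound + s + QQ  ≡⟨ cong (restDegSqBound + s +_) (d3-small restVertices Y≤4) ⟨
    restDegSqBound + s + (E * E + E) ≡⟨ +-comm (restDegSqBound + s) (E * E + E) ⟩
    E * E + E + (restDegSqBound + s) ≡⟨ +-assoc (E * E + E) restDegSqBound s ⟨
    E * E + E + restDegSqBound + s ∎
    where
    open ≤-Reasoning
    X = restEdges
    E = d3Edges restVertices
    QQ = d3DegSqSum restVertices

  rest-bound : RestBound 0 ⊎ (restVertices ≡ 4 × restEdges ≤ 2 × RestBound 2)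
  rest-bound with 5 ≤? restVertices
  ... | yes 5≤Y = inj₁ (≤-trans (rest-large 5≤Y) (≤-reflexive (sym (+-identityʳ _))))
  ... | no 5≰Y with ≤-pred (≰⇒> 5≰Y)
  ...   | Y≤4 with small-census C Y≤4
  ...     | inj₁ bound = inj₁ (small-rest-bound Y≤4 0 bound)
  ...     | inj₂ (Y≡4 , X≤2 , bound) = inj₂ (Y≡4 , X≤2 , small-rest-bound Y≤4 2 bound)

  census-bound : ∀ s → (vertices ≡ 4 → 2 ≤ s) →
    edges * edges + edges + d3DegSqSum vertices ≤ d3Edges vertices * d3Edges vertices + d3Edges vertices + degSqLowerBound + s
  census-bound s four⇒2≤s with m≤n⇒∃[o]m+o≡n restEdges≤d3Edges
  ... | δ , X+δ≡E = begin
    edges * edges + edges + d3DegSqSum vertices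
      ≡⟨ cong (edges * edges + edges +_) (d3DegSqSum-shift triangles restVertices) ⟩
    edges * edges + edges + (12 * triangles + d3DegSqSum restVertices)
      ≤⟨ by-rest-bound rest-bound ⟩
    (3 * triangles + (X + δ)) * (3 * triangles + (X + δ)) + (3 * triangles + (X + δ)) + degSqLowerBound + s
      ≡⟨ cong (λ e → (3 * triangles + e) * (3 * triangles + e) + (3 * triangles + e) + degSqLowerBound + s) X+δ≡E ⟩
    (3 * triangles + E) * (3 * triangles + E) + (3 * triangles + E) + degSqLowerBound + s
      ≡⟨ cong (λ e → e * e + e + degSqLowerBound + s) (d3Edges-shift triangles restVertices) ⟨
    d3Edges vertices * d3Edges vertices + d3Edges vertices + degSqLowerBound + s ∎
    where
    open ≤-Reasoning
    X = restEdges
    E = d3Edges restVertices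
    lift : ∀ {r} → RestBound r → r ≤ 6 * triangles * δ + s →
      edges * edges + edges + (12 * triangles + d3DegSqSum restVertices)
        ≤ (3 * triangles + (X + δ)) * (3 * triangles + (X + δ)) + (3 * triangles + (X + δ)) + degSqLowerBound + s
    lift {r} bound = lift-by-triangles triangles X δ (d3DegSqSum restVertices) restDegSqBound r s
                       (subst (λ e → X * X + X + d3DegSqSum restVertices ≤ e * e + e + restDegSqBound + r) (sym X+δ≡E) bound)
    by-rest-bound : RestBound 0 ⊎ (restVertices ≡ 4 × X ≤ 2 × RestBound 2) →
      edges * edges + edges + (12 * triangles + d3DegSqSum restVertices)
        ≤ (3 * triangles + (X + δ)) * (3 * triangles + (X + δ)) + (3 * triangles + (X + δ)) + degSqLowerBound + s
    by-rest-bound (inj₁ bound) = lift bound z≤n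
    by-rest-bound (inj₂ (Y≡4 , X≤2 , bound)) with triangles ≟ℕ 0
    ... | yes t≡0 = lift bound (≤-trans (four⇒2≤s (trans (cong (λ t → 3 * t + restVertices) t≡0) Y≡4)) (m≤n+m s _))
    ... | no t≢0 =
      lift bound (≤-trans (≤-trans (m≤m+n 2 4) (*-mono-≤ (*-monoʳ-≤ 6 (n≢0⇒n>0 t≢0)) (n≢0⇒n>0 δ≢0))) (m≤m+n _ s))
      where
      δ≢0 : δ ≢ 0
      δ≢0 refl = <-irrefl refl (≤-trans (≤-reflexive (sym (trans (sym (+-identityʳ X)) (trans X+δ≡E (cong d3Edges Y≡4))))) X≤2)

m2-comparison : ∀ {m q e m′ q′ e′ b s} → 2 * m + q ≡ e * e + e → 2 * m′ + q′ ≡ e′ * e′ + e′ →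
  e * e + e + q′ ≤ e′ * e′ + e′ + b + 2 * s → b ≤ q → m ≤ m′ + s
m2-comparison {m} {q} {e} {m′} {q′} {e′} {b} {s} identity identity′ bound b≤q =
  *-cancelˡ-≤ 2 (+-cancelʳ-≤ (q + q′) (2 * m) (2 * (m′ + s)) (begin
    2 * m + (q + q′)              ≡⟨ +-assoc (2 * m) q q′ ⟨
    2 * m + q + q′                ≡⟨ cong (_+ q′) identity ⟩
    e * e + e + q′                ≤⟨ bound ⟩
    e′ * e′ + e′ + b + 2 * s      ≤⟨ +-monoˡ-≤ (2 * s) (+-monoʳ-≤ (e′ * e′ + e′) b≤q) ⟩
    e′ * e′ + e′ + q + 2 * s      ≡⟨ cong (λ x → x + q + 2 * s) identity′ ⟨
    2 * m′ + q′ + q + 2 * s       ≡⟨ regroup m′ q′ q s ⟩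
    2 * (m′ + s) + (q + q′) ∎))
  where
  open ≤-Reasoning
  regroup : ∀ m q′ q s → 2 * m + q′ + q + 2 * s ≡ 2 * (m + s) + (q + q′)
  regroup = solve-∀

P4Free⇒NM2≤NM2-D3 : ∀ {n} (G : Graph n) → P4Free G → ∀ s → (n ≡ 4 → 1 ≤ s) → NM2 G ≤ NM2 (D3 n) + s
P4Free⇒NM2≤NM2-D3 {n} G free s four⇒1≤s
  rewrite NM2≡m2Count G | NM2≡m2Count (D3 n) =
  m2-comparison {e = edges} {e′ = d3Edges n} {b = degSqLowerBound} {s = s}
                (trans (m2-identity G) (cong (λ e → e * e + e) census-edges))
                (trans (m2-identity (D3 n)) (cong (λ e → e * e + e) (edgeCount-D3 n)))
                bound census-degSq
  where
  open P4FreeStructure G free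
  open Census census using (vertices; edges; degSqLowerBound)
  bound : edges * edges + edges + degSqSum (D3 n) ≤ d3Edges n * d3Edges n + d3Edges n + degSqLowerBound + 2 * s
  bound = subst (λ q → edges * edges + edges + q ≤ d3Edges n * d3Edges n + d3Edges n + degSqLowerBound + 2 * s) (sym (degSqSum-D3 n))
            (subst (λ k → edges * edges + edges + d3DegSqSum k ≤ d3Edges k * d3Edges k + d3Edges k + degSqLowerBound + 2 * s)
                   (sym census-vertices)
                   (CensusBounds.census-bound census (2 * s) λ four → *-monoʳ-≤ 2 (four⇒1≤s (trans census-vertices four))))

twoEdges : Graph 4
adj twoEdges i j = i ≠ᵇ j ∧ does ((toℕ i / 2) ≟ℕ (toℕ j / 2))
adj-sym twoEdges i j = cong₂ _∧_ (≠ᵇ-sym i j) (≟ℕ-sym (toℕ i / 2) (toℕ j / 2))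
adj-irrefl twoEdges zero = refl
adj-irrefl twoEdges (suc zero) = refl
adj-irrefl twoEdges (suc (suc zero)) = refl
adj-irrefl twoEdges (suc (suc (suc zero))) = refl

twoEdges-P4Free : P4Free twoEdges
twoEdges-P4Free (a , b , c , _ , _ , a≢c , _ , _ , _ , _ , ab , bc , _) =
  <-irrefl refl (≤-trans (two-nbrs⇒deg≥2 twoEdges {b} (adj-swap twoEdges {a} ab) bc a≢c) (deg≤1 b))
  where
  deg≤1 : ∀ v → deg twoEdges v ≤ 1
  deg≤1 zero = ≤-refl
  deg≤1 (suc zero) = ≤-refl
  deg≤1 (suc (suc zero)) = ≤-refl
  deg≤1 (suc (suc (suc zero))) = ≤-refl

proposition3p6 : ((n : ℕ) → n ≢ 4 → ExM2P4 n (NM2 (D3 n))) × ExM2P4 4 1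
proposition3p6 = extremal-D3 , extremal-4
  where
  extremal-D3 : (n : ℕ) → n ≢ 4 → ExM2P4 n (NM2 (D3 n))
  extremal-D3 n n≢4 = (D3 n , D3-P4Free n , refl) ,
    λ G free → subst (NM2 G ≤_) (+-identityʳ _) (P4Free⇒NM2≤NM2-D3 G free 0 (⊥-elim ∘ n≢4))
  extremal-4 : ExM2P4 4 1
  extremal-4 = (twoEdges , twoEdges-P4Free , refl) , λ G free → P4Free⇒NM2≤NM2-D3 G free 1 (λ _ → ≤-refl)
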